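{- Let $s,n,k$ be positive integers, let $b\in\mathbb{Z}$, and let $d_1,\ldots,d_{\tau(n)}$ be the positive divisors of $n$. Let $t_1,\ldots,t_k$ be given positive divisors of $n$, and for $1\leq j\leq\tau(n)$ let $g_j=|\{i\in\{1,\ldots,k\}: t_i=d_j\}|$ (equivalently, $g_j$ is the number of the $x_i$ lying in $\mathcal{C}_{j,s}=\{1\leq x\leq n^s : (x,n^s)_s=d_j^s\}$). Then the number of $k$-tuples $(x_1,\ldots,x_k)$ with $1\leq x_i\leq n^s$ and $(x_i,n^s)_s=t_i^s$ for $i=1,\ldots,k$, satisfying $$x_1+\cdots+x_k\equiv b \pmod{n^s},$$ equals $$\frac{1}{n^s}\sum_{d\mid n} c_{d,s}(b)\prod_{j=1}^{\tau(n)}\left(c_{\frac{n}{d_j},s}\!\left(\frac{n^s}{d^s}\right)\right)^{g_j}.$$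
   Context: For a positive integer $s$ and integers $a,b$ not both zero, the generalized gcd $(a,b)_s$ is the largest $s$-th power $l^s$ of a positive integer $l$ dividing both $a$ and $b$. $\tau(n)$ denotes the number of positive divisors of $n$. Write $e(x)=\exp(2\pi i x)$. For positive integers $r,s$ and an integer $m$, Cohen's generalized Ramanujan sum is $c_{r,s}(m)=\sum_{1\leq j\leq r^s,\ (j,r^s)_s=1} e\!\left(\frac{mj}{r^s}\right)$; for $s=1$ this is the usual Ramanujan sum. -}

module Defs where

open import Level using (Level)
open import Data.Nat as ℕ using (ℕ; zero; suc; _^_; NonZero)
open import Data.Nat.Divisibility using (_∣_; _∣?_)
open import Data.Nat.DivMod using (_/_)
open import Data.Integer as ℤ using (ℤ; +_)
open import Data.Integer.DivMod using (_%ℕ_)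
open import Data.List using (List; []; _∷_; filter; length; map; concatMap; foldr)
open import Data.Vec as Vec using (Vec; []; _∷_)
open import Data.Fin using (Fin)
open import Data.Product using (_×_; _,_)
open import Relation.Nullary using (Dec; yes; no; ¬_)
open import Relation.Nullary.Decidable using (_×-dec_)
open import Relation.Binary.PropositionalEquality using (_≡_)
open import Algebra.Bundles using (CommutativeRing)

-- total versions of mod / div (the modulus is always ≥ 1 where used)
modZ : ℤ → ℕ → ℕ
modZ a zero    = 0
modZ a (suc m) = a %ℕ suc m

divN : ℕ → ℕ → ℕ
divN a zero    = 0
divN a (suc m) = a / suc m

range : ℕ → ℕ → List ℕ
range a b = go (suc b ℕ.∸ a) a
  where
  go : ℕ → ℕ → List ℕ
  go zero    _ = []
  go (suc k) x = x ∷ go k (suc x)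

divisors : ℕ → List ℕ
divisors n = filter (λ d → d ∣? n) (range 1 n)

searchL : ℕ → ℕ → ℕ → ℕ → ℕ
searchL s a b zero = 1
searchL s a b (suc k) with ((suc k ^ s) ∣? a) ×-dec ((suc k ^ s) ∣? b)
... | yes _ = suc k
... | no  _ = searchL s a b k

-- generalized gcd (a,b)_s : the largest s-th power l^s (l ≥ 1) dividing both a and b.
-- (for s ≥ 1 and a,b not both zero, any such l satisfies l ≤ a + b)
gcdS : ℕ → ℕ → ℕ → ℕ
gcdS s a b = searchL s a b (a ℕ.+ b) ^ s

tuples : (k : ℕ) → List ℕ → List (Vec ℕ k)
tuples zero    xs = [] ∷ []
tuples (suc k) xs = concatMap (λ x → map (x ∷_) (tuples k xs)) xs

module _ {c ℓ : Level} (R : CommutativeRing c ℓ) where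
  open CommutativeRing R

  pow : Carrier → ℕ → Carrier
  pow x zero    = 1#
  pow x (suc k) = x * pow x k

  natR : ℕ → Carrier
  natR zero    = 0#
  natR (suc k) = 1# + natR k

  sumR : List Carrier → Carrier
  sumR = foldr _+_ 0#

  prodR : List Carrier → Carrier
  prodR = foldr _*_ 1#

  IsPrimitiveRoot : Carrier → ℕ → Set ℓ
  IsPrimitiveRoot ζ N = (pow ζ N ≈ 1#) × (∀ k → 0 ℕ.< k → k ℕ.< N → ¬ (pow ζ k ≈ 1#))

  IsIntegralDomain : Set (c Level.⊔ ℓ)
  IsIntegralDomain = (¬ (1# ≈ 0#)) × (∀ x y → x * y ≈ 0# → (x ≈ 0#) Data.Sum.⊎ (y ≈ 0#))
    where import Data.Sum

  CharZero : Set ℓ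
  CharZero = ∀ m → ¬ (natR (suc m) ≈ 0#)

  -- Cohen's generalized Ramanujan sum c_{r,s}(m), with e(x) realised through ζ,
  -- a primitive N-th root of unity, where r^s ∣ N:
  --   e(m j / r^s) = ζ ^ ((N / r^s) * ((m j) mod r^s)).
  cohen : (ζ : Carrier) (N r s : ℕ) → ℤ → Carrier
  cohen ζ N r s m =
    sumR (map (λ j → pow ζ (divN N (r ^ s) ℕ.* modZ (m ℤ.* + j) (r ^ s)))
              (filter (λ j → gcdS s j (r ^ s) Data.Nat.≟ 1) (range 1 (r ^ s))))
    where import Data.Nat

countSol : (n s k : ℕ) → (Fin k → ℕ) → ℤ → ℕ
countSol n s k t b =
  length (filter P (tuples k (range 1 (n ^ s))))
  where
  open import Data.Vec.Relation.Unary.All as All using (All)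
  import Data.Nat as N
  P : (xs : Vec ℕ k) → Dec ((All (λ (xt : ℕ × ℕ) → gcdS s (Data.Product.proj₁ xt) (n ^ s) ≡ Data.Product.proj₂ xt ^ s) (Vec.zip xs (Vec.tabulate t))) × (modZ ((+ Vec.sum xs) ℤ.- b) (n ^ s) ≡ 0))
  P xs = All.all? (λ xt → gcdS s (Data.Product.proj₁ xt) (n ^ s) N.≟ Data.Product.proj₂ xt ^ s) (Vec.zip xs (Vec.tabulate t))
         ×-dec (modZ ((+ Vec.sum xs) ℤ.- b) (n ^ s) N.≟ 0)
    where import Data.Product

multiplicity : (k : ℕ) → (Fin k → ℕ) → ℕ → ℕ
multiplicity k t d = length (filter (λ x → x Data.Nat.≟ d) (Vec.toList (Vec.tabulate t)))
  where import Data.Nat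

{-# OPTIONS --safe #-}
-- Write N = n^s and e(a) = ζ^(a mod N). By orthogonality, N times the number of solutions is
-- Σ_{m ≤ N} e(m b) Π_i S(t_i, -m), where S(t, c) sums e(c x) over the class {x ≤ N : (x, N)_s = t^s};
-- substituting x = t^s y identifies S(t, c) with Cohen's sum c_{n/t,s}(c).  S(t, c) depends only on
-- the class of c: summing S(v, c) over the multiples v of u gives the sum of e(c x) over the multiples x
-- of u^s, which only sees whether N ∣ u^s c, and downward induction over the divisors of n inverts this.
-- Grouping m by its class (n/d)^s for d ∣ n, and collecting equal t_i into the exponents g_j, gives the
-- formula.
module Submission where

open import Defs
open import Level using (Level)
open import Algebra.Bundles using (CommutativeRing; CommutativeMonoid; Monoid; Ring)
open import Data.Bool using (true; false; if_then_else_)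
open import Data.Fin as Fin using (Fin)
open import Data.Integer as ℤ using (ℤ; +_)
import Data.Integer.Properties as ℤ
open import Data.Integer.DivMod using (_%ℕ_; _/ℕ_; a≡a%ℕn+[a/ℕn]*n; n%ℕd<d)
open import Data.Integer.Divisibility.Signed using (divides; ∣m⇒∣-m; ∣n⇒∣m*n) renaming (_∣_ to _∣ℤ_; _∣?_ to _∣ℤ?_)
open import Data.List using (List; []; _∷_; _++_; map; filter; concatMap; length; foldr)
open import Data.List.Properties using (map-∘)
open import Data.Nat as ℕ using (ℕ; zero; suc; _≤_; _<_; _^_; NonZero; z<s)
import Data.Nat.Properties as ℕ
open import Data.Nat.Divisibility using (_∣_; _∣?_; ∣-refl; ∣⇒≤; ∣m+n∣m⇒∣n; ∣m⇒∣m*n; m∣m*n)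
open import Data.Product using (_,_; proj₁; proj₂)
open import Data.Sum using (inj₁; inj₂)
open import Data.Vec as Vec using (Vec; []; _∷_)
open import Data.Vec.Relation.Unary.All as All using (All)
open import Function using (_∘_)
open import Function.Bundles using (_⇔_; mk⇔; Equivalence)
import Function.Properties.Equivalence as ⇔
open import Relation.Nullary using (Dec; yes; no; does; ¬_; contradiction; _×-dec_)
open import Relation.Unary using (Pred; Decidable)
open import Relation.Binary.PropositionalEquality as ≡ using (_≡_)

private
  variable
    a b p q : Level
    A : Set a
    B : Set b

module Arithmetic where
  open import Data.Nat
  open import Data.Nat.Properties
  open import Data.Nat.Divisibility
  open import Data.Nat.DivMod using (_/_; m*n/n≡m)
  open import Data.Nat.GCD
  open import Data.Nat.LCM
  open import Data.Nat.Coprimality as Coprimality using (Coprime)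
  open import Data.Nat.Tactic.RingSolver using (solve-∀)
  open import Data.Product using (_×_)
  open import Relation.Binary.Definitions using (tri<; tri≈; tri>)
  open import Relation.Binary.PropositionalEquality

  ^-distribʳ-* : ∀ s a b → (a * b) ^ s ≡ a ^ s * b ^ s
  ^-distribʳ-* zero    a b = refl
  ^-distribʳ-* (suc s) a b rewrite ^-distribʳ-* s a b = interchange a b (a ^ s) (b ^ s)
    where
    interchange : ∀ a b x y → a * b * (x * y) ≡ a * x * (b * y)
    interchange = solve-∀

  m^s≡n^s⇒m≡n : ∀ s → 0 < s → ∀ {m n} → m ^ s ≡ n ^ s → m ≡ n
  m^s≡n^s⇒m≡n s@(suc _) _ {m} {n} eq with <-cmp m n
  ... | tri< m<n _ _ = contradiction eq (<⇒≢ (^-monoˡ-< s m<n))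
  ... | tri≈ _ m≡n _ = m≡n
  ... | tri> _ _ n<m = contradiction eq (>⇒≢ (^-monoˡ-< s n<m))

  m≤m^s : ∀ s → 0 < s → ∀ {m} → 0 < m → m ≤ m ^ s
  m≤m^s (suc s) _ {m} 0<m = begin
    m         ≡⟨ *-identityʳ m ⟨
    m * 1     ≤⟨ *-monoʳ-≤ m (m^n>0 m {{>-nonZero 0<m}} s) ⟩
    m * m ^ s ∎
    where open ≤-Reasoning

  ^-monoˡ-∣ : ∀ s {a b} → a ∣ b → a ^ s ∣ b ^ s
  ^-monoˡ-∣ zero    _   = ∣-refl
  ^-monoˡ-∣ (suc s) a∣b = *-pres-∣ a∣b (^-monoˡ-∣ s a∣b)

  ∣-pos : ∀ {m n} → 0 < n → m ∣ n → 0 < m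
  ∣-pos {zero}  0<n 0∣n = contradiction (0∣⇒≡0 0∣n) (>⇒≢ 0<n)
  ∣-pos {suc m} _   _   = z<s

  ^∣-pos : ∀ s → 0 < s → ∀ {m n} → 0 < n → m ^ s ∣ n → 0 < m
  ^∣-pos (suc s) _ {zero}  0<n 0∣n = contradiction (0∣⇒≡0 0∣n) (>⇒≢ 0<n)
  ^∣-pos (suc s) _ {suc m} _   _   = z<s

  coprime-*ˡ : ∀ {a b c} → Coprime a c → Coprime b c → Coprime (a * b) c
  coprime-*ˡ {a} {b} {c} a⊥c b⊥c {d} (d∣ab , d∣c) = b⊥c (d∣b , d∣c)
    where
    d⊥a : Coprime d a
    d⊥a (e∣d , e∣a) = a⊥c (e∣a , ∣-trans e∣d d∣c)
    d∣b : d ∣ b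
    d∣b = Coprimality.coprime-divisor d⊥a d∣ab

  coprime-^ˡ : ∀ s {a b} → Coprime a b → Coprime (a ^ s) b
  coprime-^ˡ zero    _   (d∣1 , _) = ∣1⇒≡1 d∣1
  coprime-^ˡ (suc s) a⊥b = coprime-*ˡ a⊥b (coprime-^ˡ s a⊥b)

  coprime-^ : ∀ s {a b} → Coprime a b → Coprime (a ^ s) (b ^ s)
  coprime-^ s a⊥b = Coprimality.sym (coprime-^ˡ s (Coprimality.sym (coprime-^ˡ s a⊥b)))

  gcd-^ : ∀ s a b → 0 < a → gcd (a ^ s) (b ^ s) ≡ gcd a b ^ s
  gcd-^ s a b 0<a = begin
    gcd (a ^ s) (b ^ s)
      ≡⟨ cong₂ (λ x y → gcd (x ^ s) (y ^ s)) a≡a'g b≡b'g ⟩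
    gcd ((a' * g) ^ s) ((b' * g) ^ s)
      ≡⟨ cong₂ gcd (power-swap a') (power-swap b') ⟩
    gcd (g ^ s * a' ^ s) (g ^ s * b' ^ s)
      ≡⟨ c*gcd[m,n]≡gcd[cm,cn] (g ^ s) (a' ^ s) (b' ^ s) ⟨
    g ^ s * gcd (a' ^ s) (b' ^ s)
      ≡⟨ cong (g ^ s *_) (Coprimality.coprime⇒gcd≡1 (coprime-^ s a'⊥b')) ⟩
    g ^ s * 1
      ≡⟨ *-identityʳ (g ^ s) ⟩
    g ^ s                                      ∎
    where
    open ≡-Reasoning
    g = gcd a b
    instance
      g≢0 : NonZero g
      g≢0 = ≢-nonZero (gcd[m,n]≢0 a b (inj₁ (>⇒≢ 0<a)))
    a' b' : ℕ
    a' = quotient (gcd[m,n]∣m a b)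
    b' = quotient (gcd[m,n]∣n a b)
    a≡a'g : a ≡ a' * g
    a≡a'g = m∣n⇒n≡quotient*m (gcd[m,n]∣m a b)
    b≡b'g : b ≡ b' * g
    b≡b'g = m∣n⇒n≡quotient*m (gcd[m,n]∣n a b)
    power-swap : ∀ x → (x * g) ^ s ≡ g ^ s * x ^ s
    power-swap x = trans (^-distribʳ-* s x g) (*-comm (x ^ s) (g ^ s))
    a'⊥b' : Coprime a' b'
    a'⊥b' {d} (d∣a' , d∣b') = ∣1⇒≡1 (*-cancelʳ-∣ g (subst (d * g ∣_) (sym (*-identityˡ g)) dg∣g))
      where
      dg∣g : d * g ∣ g
      dg∣g = gcd-greatest (subst (d * g ∣_) (sym a≡a'g) (*-monoˡ-∣ g d∣a'))
                          (subst (d * g ∣_) (sym b≡b'g) (*-monoˡ-∣ g d∣b'))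

  lcm-^ : ∀ s a b → 0 < a → lcm a b ^ s ≡ lcm (a ^ s) (b ^ s)
  lcm-^ s a b 0<a = *-cancelˡ-≡ _ _ (g ^ s) {{m^n≢0 g s}} (begin
    g ^ s * lcm a b ^ s                         ≡⟨ ^-distribʳ-* s g (lcm a b) ⟨
    (g * lcm a b) ^ s                           ≡⟨ cong (_^ s) (gcd*lcm a b) ⟩
    (a * b) ^ s                                 ≡⟨ ^-distribʳ-* s a b ⟩
    a ^ s * b ^ s                               ≡⟨ gcd*lcm (a ^ s) (b ^ s) ⟨
    gcd (a ^ s) (b ^ s) * lcm (a ^ s) (b ^ s)   ≡⟨ cong (_* lcm (a ^ s) (b ^ s)) (gcd-^ s a b 0<a) ⟩
    g ^ s * lcm (a ^ s) (b ^ s)                 ∎)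
    where
    open ≡-Reasoning
    g = gcd a b
    instance
      g≢0 : NonZero g
      g≢0 = ≢-nonZero (gcd[m,n]≢0 a b (inj₁ (>⇒≢ 0<a)))

  lcm-^-least : ∀ s {a b c} → 0 < a → a ^ s ∣ c → b ^ s ∣ c → lcm a b ^ s ∣ c
  lcm-^-least s {a} {b} 0<a a^s∣c b^s∣c = subst (_∣ _) (sym (lcm-^ s a b 0<a)) (lcm-least a^s∣c b^s∣c)

  m^s∣n^s⇒m∣n : ∀ s → 0 < s → ∀ {m n} → 0 < m → m ^ s ∣ n ^ s → m ∣ n
  m^s∣n^s⇒m∣n s 0<s {m} {n} 0<m m^s∣n^s = subst (_∣ n) gcd≡m (gcd[m,n]∣n m n)
    where
    gcd≡m : gcd m n ≡ m
    gcd≡m = m^s≡n^s⇒m≡n s 0<s (trans (sym (gcd-^ s m n 0<m))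
              (∣-antisym (gcd[m,n]∣m _ _) (gcd-greatest ∣-refl m^s∣n^s)))

  m∣n⇒n≡m*divN : ∀ {m n} → m ∣ n → n ≡ m * divN n m
  m∣n⇒n≡m*divN {zero}  0∣n     = 0∣⇒≡0 0∣n
  m∣n⇒n≡m*divN {suc m} m+1∣n = trans (m∣n⇒n≡m*quotient m+1∣n) (cong (suc m *_) (sym (n/m≡quotient m+1∣n)))

  divN-∣ : ∀ {m n} → m ∣ n → divN n m ∣ n
  divN-∣ {m} m∣n = divides m (m∣n⇒n≡m*divN m∣n)

  divN-cancelˡ : ∀ a b → 0 < a → divN (a * b) a ≡ b
  divN-cancelˡ (suc a) b _ = trans (cong (_/ suc a) (*-comm (suc a) b)) (m*n/n≡m b (suc a))

  divN-involutive : ∀ {m n} → 0 < n → m ∣ n → divN n (divN n m) ≡ m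
  divN-involutive {m} {n} 0<n m∣n = begin
    divN n m′            ≡⟨ cong (λ x → divN x m′) (trans (m∣n⇒n≡m*divN m∣n) (*-comm m m′)) ⟩
    divN (m′ * m) m′     ≡⟨ divN-cancelˡ m′ m (∣-pos 0<n (divN-∣ m∣n)) ⟩
    m                    ∎
    where
    open ≡-Reasoning
    m′ = divN n m

  divN-^ : ∀ s {d n} → 0 < n → d ∣ n → divN (n ^ s) (d ^ s) ≡ divN n d ^ s
  divN-^ s {d} {n} 0<n d∣n = begin
    divN (n ^ s) (d ^ s)
      ≡⟨ cong (λ x → divN (x ^ s) (d ^ s)) (m∣n⇒n≡m*divN d∣n) ⟩
    divN ((d * divN n d) ^ s) (d ^ s)
      ≡⟨ cong (λ x → divN x (d ^ s)) (^-distribʳ-* s d (divN n d)) ⟩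
    divN (d ^ s * divN n d ^ s) (d ^ s)
      ≡⟨ divN-cancelˡ (d ^ s) _ (m^n>0 d {{>-nonZero (∣-pos 0<n d∣n)}} s) ⟩
    divN n d ^ s                           ∎
    where open ≡-Reasoning

  searchL-pos : ∀ s a b K → 0 < searchL s a b K
  searchL-pos s a b zero = z<s
  searchL-pos s a b (suc K) with (suc K ^ s ∣? a) ×-dec (suc K ^ s ∣? b)
  ... | yes _ = z<s
  ... | no  _ = searchL-pos s a b K

  searchL-∣ : ∀ s a b K → searchL s a b K ^ s ∣ a × searchL s a b K ^ s ∣ b
  searchL-∣ s a b zero    rewrite ^-zeroˡ s = 1∣ a , 1∣ b
  searchL-∣ s a b (suc K) with (suc K ^ s ∣? a) ×-dec (suc K ^ s ∣? b)
  ... | yes both = both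
  ... | no  _    = searchL-∣ s a b K

  searchL-maximal : ∀ s a b K {l} → 0 < l → l ≤ K → l ^ s ∣ a → l ^ s ∣ b → l ≤ searchL s a b K
  searchL-maximal s a b zero    0<l l≤0 _ _ = contradiction l≤0 (<⇒≱ 0<l)
  searchL-maximal s a b (suc K) 0<l l≤K l^s∣a l^s∣b with (suc K ^ s ∣? a) ×-dec (suc K ^ s ∣? b)
  ... | yes _ = l≤K
  ... | no ¬both with m≤n⇒m<n∨m≡n l≤K
  ...   | inj₁ l<1+K = searchL-maximal s a b K 0<l (≤-pred l<1+K) l^s∣a l^s∣b
  ...   | inj₂ refl  = contradiction (l^s∣a , l^s∣b) ¬both

  gcdRoot : ℕ → ℕ → ℕ → ℕ
  gcdRoot s a b = searchL s a b (a + b)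

  module _ (s : ℕ) (0<s : 0 < s) {b : ℕ} (0<b : 0 < b) where

    gcdRoot-pos : ∀ a → 0 < gcdRoot s a b
    gcdRoot-pos a = searchL-pos s a b (a + b)

    gcdRoot^∣ˡ : ∀ a → gcdRoot s a b ^ s ∣ a
    gcdRoot^∣ˡ a = proj₁ (searchL-∣ s a b (a + b))

    gcdRoot^∣ʳ : ∀ a → gcdRoot s a b ^ s ∣ b
    gcdRoot^∣ʳ a = proj₂ (searchL-∣ s a b (a + b))

    -- maximality applied to lcm l r, whose s-th power still divides a and b
    gcdRoot-greatest : ∀ {a l} → l ^ s ∣ a → l ^ s ∣ b → l ∣ gcdRoot s a b
    gcdRoot-greatest {a} {l} l^s∣a l^s∣b = subst (l ∣_) L≡r (m∣lcm[m,n] l r)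
      where
      r = gcdRoot s a b
      L = lcm l r
      L^s∣a : L ^ s ∣ a
      L^s∣a = lcm-^-least s (^∣-pos s 0<s 0<b l^s∣b) l^s∣a (gcdRoot^∣ˡ a)
      L^s∣b : L ^ s ∣ b
      L^s∣b = lcm-^-least s (^∣-pos s 0<s 0<b l^s∣b) l^s∣b (gcdRoot^∣ʳ a)
      0<L : 0 < L
      0<L = ^∣-pos s 0<s 0<b L^s∣b
      L≤a+b : L ≤ a + b
      L≤a+b = ≤-trans (m≤m^s s 0<s 0<L) (≤-trans (∣⇒≤ {{>-nonZero 0<b}} L^s∣b) (m≤n+m b a))
      L≡r : L ≡ r
      L≡r = ≤-antisym (searchL-maximal s a b (a + b) 0<L L≤a+b L^s∣a L^s∣b)
                      (∣⇒≤ {{>-nonZero 0<L}} (n∣lcm[m,n] l r))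

    gcdRoot-unique : ∀ {a t} → t ^ s ∣ a → t ^ s ∣ b → (∀ {l} → l ^ s ∣ a → l ^ s ∣ b → l ∣ t) → gcdRoot s a b ≡ t
    gcdRoot-unique {a} t^s∣a t^s∣b greatest =
      ∣-antisym (greatest (gcdRoot^∣ˡ a) (gcdRoot^∣ʳ a)) (gcdRoot-greatest t^s∣a t^s∣b)

    gcdS≡^⇔gcdRoot≡ : ∀ a t → gcdS s a b ≡ t ^ s ⇔ gcdRoot s a b ≡ t
    gcdS≡^⇔gcdRoot≡ _ _ = mk⇔ (m^s≡n^s⇒m≡n s 0<s) (cong (_^ s))

  module DivisorClasses (s n : ℕ) (0<s : 0 < s) (0<n : 0 < n) where

    N : ℕ
    N = n ^ s

    0<N : 0 < N
    0<N = m^n>0 n {{>-nonZero 0<n}} s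

    -- x lies in the class 𝒞_j of the paper exactly when classOf x ≡ d_j
    classOf : ℕ → ℕ
    classOf x = gcdRoot s x N

    classOf∣n : ∀ x → classOf x ∣ n
    classOf∣n x = m^s∣n^s⇒m∣n s 0<s (gcdRoot-pos s 0<s 0<N x) (gcdRoot^∣ʳ s 0<s 0<N x)

    ∣classOf⇔ : ∀ {u} x → u ∣ n → (u ∣ classOf x ⇔ u ^ s ∣ x)
    ∣classOf⇔ x u∣n = mk⇔ (λ u∣r → ∣-trans (^-monoˡ-∣ s u∣r) (gcdRoot^∣ˡ s 0<s 0<N x))
                          (λ u^s∣x → gcdRoot-greatest s 0<s 0<N u^s∣x (^-monoˡ-∣ s u∣n))

    classOf-^ : ∀ {e} → e ∣ n → classOf (e ^ s) ≡ e
    classOf-^ {e} e∣n = gcdRoot-unique s 0<s 0<N ∣-refl (^-monoˡ-∣ s e∣n)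
      (λ l^s∣e^s _ → m^s∣n^s⇒m∣n s 0<s (^∣-pos s 0<s (m^n>0 e {{>-nonZero (∣-pos 0<n e∣n)}} s) l^s∣e^s) l^s∣e^s)

    module _ {t : ℕ} (t∣n : t ∣ n) where
      private
        T D : ℕ
        T = t ^ s
        D = divN n t ^ s
        N≡T*D : N ≡ T * D
        N≡T*D = trans (cong (_^ s) (m∣n⇒n≡m*divN t∣n)) (^-distribʳ-* s t (divN n t))
        0<D : 0 < D
        0<D = m^n>0 (divN n t) {{>-nonZero (∣-pos 0<n (divN-∣ t∣n))}} s
        instance
          T≢0 : NonZero T
          T≢0 = m^n≢0 t s {{>-nonZero (∣-pos 0<n t∣n)}}

      classOf-scale : ∀ y → classOf (T * y) ≡ t ⇔ gcdRoot s y D ≡ 1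
      classOf-scale y = mk⇔ to from
        where
        to : classOf (T * y) ≡ t → gcdRoot s y D ≡ 1
        to r≡t = ∣1⇒≡1 (*-cancelʳ-∣ t {{>-nonZero (∣-pos 0<n t∣n)}}
                         (subst (w * t ∣_) (trans r≡t (sym (*-identityˡ t))) wt∣r))
          where
          w = gcdRoot s y D
          wt^s≡ : (w * t) ^ s ≡ w ^ s * T
          wt^s≡ = ^-distribʳ-* s w t
          wt∣r : w * t ∣ classOf (T * y)
          wt∣r = gcdRoot-greatest s 0<s 0<N
            (subst₂ _∣_ (sym wt^s≡) (*-comm y T) (*-monoˡ-∣ T (gcdRoot^∣ˡ s 0<s 0<D y)))
            (subst₂ _∣_ (sym wt^s≡) (trans (*-comm D T) (sym N≡T*D)) (*-monoˡ-∣ T (gcdRoot^∣ʳ s 0<s 0<D y)))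
        -- t divides the class r of T y; writing r = w t, the cofactor w^s divides both y and D
        from : gcdRoot s y D ≡ 1 → classOf (T * y) ≡ t
        from root≡1 = trans r≡w*t (trans (cong (_* t) w≡1) (*-identityˡ t))
          where
          t∣r : t ∣ classOf (T * y)
          t∣r = gcdRoot-greatest s 0<s 0<N (m∣m*n y) (^-monoˡ-∣ s t∣n)
          w : ℕ
          w = quotient t∣r
          r≡w*t : classOf (T * y) ≡ w * t
          r≡w*t = m∣n⇒n≡quotient*m t∣r
          r^s≡ : classOf (T * y) ^ s ≡ w ^ s * T
          r^s≡ = trans (cong (_^ s) r≡w*t) (^-distribʳ-* s w t)
          w^s∣y : w ^ s ∣ y
          w^s∣y = *-cancelʳ-∣ T (subst₂ _∣_ r^s≡ (*-comm T y) (gcdRoot^∣ˡ s 0<s 0<N (T * y)))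
          w^s∣D : w ^ s ∣ D
          w^s∣D = *-cancelʳ-∣ T (subst₂ _∣_ r^s≡ (trans N≡T*D (*-comm T D)) (gcdRoot^∣ʳ s 0<s 0<N (T * y)))
          w≡1 : w ≡ 1
          w≡1 = ∣1⇒≡1 (subst (w ∣_) root≡1 (gcdRoot-greatest s 0<s 0<D w^s∣y w^s∣D))

      N∣T*m⇔ : ∀ m → N ∣ T * m ⇔ divN n t ∣ classOf m
      N∣T*m⇔ m = ⇔.trans (mk⇔ cancel (λ v^s∣m → subst (_∣ T * m) (sym N≡T*D) (*-monoʳ-∣ T v^s∣m)))
                         (⇔.sym (∣classOf⇔ m (divN-∣ t∣n)))
        where
        cancel : N ∣ T * m → D ∣ m
        cancel N∣Tm = *-cancelˡ-∣ T (subst (_∣ T * m) N≡T*D N∣Tm)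

module IntegerResidues where
  open import Data.Integer hiding (NonZero)
  open import Data.Integer.Properties using ([+m]-[+n]≡m⊖n; ⊖-≥; +-identityˡ)
  open import Data.Integer.DivMod using (_%ℕ_; _/ℕ_; a≡a%ℕn+[a/ℕn]*n; n%ℕd<d)
  open import Data.Integer.Divisibility.Signed using (∣⇒∣ᵤ; ∣ᵤ⇒∣; ∣m∣n⇒∣m-n)
  open import Data.Integer.Tactic.RingSolver using (solve-∀)
  open import Data.Nat.Divisibility using (>⇒∤)
  open import Data.Nat.DivMod using (m*n%n≡0)
  open import Relation.Binary.PropositionalEquality

  private
    ∣∧<⇒≡0 : ∀ {N x} → x ℕ.< N → N ∣ x → x ≡ 0
    ∣∧<⇒≡0 {x = zero}  _   _   = refl
    ∣∧<⇒≡0 {x = suc x} x<N N∣x = contradiction N∣x (>⇒∤ x<N)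

    ∣-difference-sym : ∀ {d} a b → d ∣ℤ a - b → d ∣ℤ b - a
    ∣-difference-sym {d} a b = subst (d ∣ℤ_) (negate-difference a b) ∘ ∣m⇒∣-m
      where
      negate-difference : ∀ a b → - (a - b) ≡ b - a
      negate-difference = solve-∀

    residue-unique-≤ : ∀ {N r r′} → r′ ℕ.≤ r → r ℕ.< N → + N ∣ℤ + r - + r′ → r ≡ r′
    residue-unique-≤ {N} {r} {r′} r′≤r r<N N∣r-r′ = ℕ.≤-antisym (ℕ.m∸n≡0⇒m≤n r∸r′≡0) r′≤r
      where
      r∸r′≡0 : r ℕ.∸ r′ ≡ 0
      r∸r′≡0 = ∣∧<⇒≡0 (ℕ.≤-<-trans (ℕ.m∸n≤m r r′) r<N)
                      (∣⇒∣ᵤ (subst (+ N ∣ℤ_) (trans ([+m]-[+n]≡m⊖n r r′) (⊖-≥ r′≤r)) N∣r-r′))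

  residue-unique : ∀ {N r r′} → r ℕ.< N → r′ ℕ.< N → + N ∣ℤ + r - + r′ → r ≡ r′
  residue-unique {r = r} {r′} r<N r′<N N∣r-r′ with ℕ.≤-total r′ r
  ... | inj₁ r′≤r = residue-unique-≤ r′≤r r<N N∣r-r′
  ... | inj₂ r≤r′ = sym (residue-unique-≤ r≤r′ r′<N (∣-difference-sym (+ r) (+ r′) N∣r-r′))

  %ℕ-cong : ∀ N .{{_ : NonZero N}} {a b} → + N ∣ℤ a - b → a %ℕ N ≡ b %ℕ N
  %ℕ-cong N {a} {b} N∣a-b =
    residue-unique (n%ℕd<d a N) (n%ℕd<d b N) (subst (+ N ∣ℤ_) (sym residues) (∣m∣n⇒∣m-n N∣a-b (divides (qa - qb) refl)))
    where
    qa = a /ℕ N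
    qb = b /ℕ N
    regroup : ∀ ra rb qa qb n → ra - rb ≡ ((ra + qa * n) - (rb + qb * n)) - (qa - qb) * n
    regroup = solve-∀
    residues : + (a %ℕ N) - + (b %ℕ N) ≡ (a - b) - (qa - qb) * + N
    residues = trans (regroup (+ (a %ℕ N)) (+ (b %ℕ N)) qa qb (+ N))
                     (cong₂ (λ x y → (x - y) - (qa - qb) * + N) (sym (a≡a%ℕn+[a/ℕn]*n a N)) (sym (a≡a%ℕn+[a/ℕn]*n b N)))

  ∣⇔%ℕ≡0 : ∀ N .{{_ : NonZero N}} {a} → + N ∣ℤ a ⇔ a %ℕ N ≡ 0
  ∣⇔%ℕ≡0 N {a} = mk⇔ (λ N∣a → trans (%ℕ-cong N {a} {0ℤ} (subst (+ N ∣ℤ_) (sym (+-identityʳ′ a)) N∣a)) (m*n%n≡0 0 N))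
                     (λ r≡0 → divides (a /ℕ N) (trans (a≡a%ℕn+[a/ℕn]*n a N)
                                (trans (cong (λ r → + r + (a /ℕ N) * + N) r≡0) (+-identityˡ _))))
    where
    +-identityʳ′ : ∀ a → a - 0ℤ ≡ a
    +-identityʳ′ = solve-∀

  modZ≡%ℕ : ∀ a D .{{_ : NonZero D}} → modZ a D ≡ a %ℕ D
  modZ≡%ℕ a (suc D) = refl

  +∣+⇔∣ : ∀ {m n} → + m ∣ℤ + n ⇔ m ∣ n
  +∣+⇔∣ = mk⇔ ∣⇒∣ᵤ ∣ᵤ⇒∣

open Arithmetic using (∣-pos)

interval : ℕ → ℕ → List ℕ
interval a zero    = []
interval a (suc k) = a ∷ interval (suc a) k

interval-++ : ∀ a k l → interval a (k ℕ.+ l) ≡ interval a k ++ interval (a ℕ.+ k) l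
interval-++ a zero    l = ≡.cong (λ b → interval b l) (≡.sym (ℕ.+-identityʳ a))
interval-++ a (suc k) l = ≡.cong (a ∷_) (≡.trans (interval-++ (suc a) k l)
                                                 (≡.cong (λ b → interval (suc a) k ++ interval b l) (≡.sym (ℕ.+-suc a k))))

private
  length-range : ∀ a k → suc (a ℕ.+ k) ℕ.∸ a ≡ suc k
  length-range a k = ≡.trans (ℕ.+-∸-assoc 1 (ℕ.m≤m+n a k)) (≡.cong suc (ℕ.m+n∸m≡n a k))

  <-+-suc : ∀ {y} a k → y < suc a ℕ.+ k → y < a ℕ.+ suc k
  <-+-suc {y} a k = ≡.subst (y <_) (≡.sym (ℕ.+-suc a k))

-- range is defined through a local helper, so its length argument suc (a + k) ∸ a
-- has to be abstracted before it computes
range≡interval : ∀ a k → range a (a ℕ.+ k) ≡ interval a (suc k)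
range≡interval a k with suc (a ℕ.+ k) ℕ.∸ a | length-range a k
range≡interval a zero    | _ | ≡.refl = ≡.refl
range≡interval a (suc k) | _ | ≡.refl with suc (a ℕ.+ k) ℕ.∸ a | length-range a k | range≡interval (suc a) k
... | _ | ≡.refl | IH = ≡.cong (a ∷_) IH

range-1 : ∀ M → range 1 M ≡ interval 1 M
range-1 zero    = ≡.refl
range-1 (suc M) = range≡interval 1 M

if-dec-yes : ∀ {P : Set p} (P? : Dec P) {x y : A} → P → (if does P? then x else y) ≡ x
if-dec-yes (yes _) _ = ≡.refl
if-dec-yes (no ¬p) p = contradiction p ¬p

if-dec-no : ∀ {P : Set p} (P? : Dec P) {x y : A} → ¬ P → (if does P? then x else y) ≡ y
if-dec-no (yes p) ¬p = contradiction p ¬p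
if-dec-no (no _)  _  = ≡.refl

module Folds {c ℓ : Level} (M : Monoid c ℓ) where
  open Monoid M
  open import Relation.Binary.Reasoning.Setoid setoid

  fold : List A → (A → Carrier) → Carrier
  fold L f = foldr _∙_ ε (map f L)

  fold-cong : ∀ (L : List A) {f g : A → Carrier} → (∀ x → f x ≈ g x) → fold L f ≈ fold L g
  fold-cong []      f≈g = refl
  fold-cong (x ∷ L) f≈g = ∙-cong (f≈g x) (fold-cong L f≈g)

  fold-++ : ∀ (L L′ : List A) f → fold (L ++ L′) f ≈ fold L f ∙ fold L′ f
  fold-++ []      L′ f = sym (identityˡ _)
  fold-++ (x ∷ L) L′ f = trans (∙-cong refl (fold-++ L L′ f)) (sym (assoc _ _ _))

  fold-ε : ∀ (L : List A) {f} → (∀ x → f x ≈ ε) → fold L f ≈ ε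
  fold-ε []      _   = refl
  fold-ε (x ∷ L) f≈ε = trans (∙-cong (f≈ε x) (fold-ε L f≈ε)) (identityˡ ε)

  fold-filter : ∀ {P : Pred A p} (P? : Decidable P) (L : List A) f →
                fold (filter P? L) f ≈ fold L (λ x → if does (P? x) then f x else ε)
  fold-filter P? []      f = refl
  fold-filter P? (x ∷ L) f with does (P? x)
  ... | true  = ∙-cong refl (fold-filter P? L f)
  ... | false = trans (fold-filter P? L f) (sym (identityˡ _))

  fold-concatMap : ∀ (L : List A) (g : A → List B) f →
                   fold (concatMap g L) f ≈ fold L (λ x → fold (g x) f)
  fold-concatMap []      g f = refl
  fold-concatMap (x ∷ L) g f = trans (fold-++ (g x) (concatMap g L) f) (∙-cong refl (fold-concatMap L g f))

  fold-tabulate-cong : ∀ {k} (t : Fin k → A) {f g} → (∀ i → f (t i) ≈ g (t i)) →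
                       fold (Vec.toList (Vec.tabulate t)) f ≈ fold (Vec.toList (Vec.tabulate t)) g
  fold-tabulate-cong {k = zero}  t _   = refl
  fold-tabulate-cong {k = suc k} t f≈g = ∙-cong (f≈g Fin.zero) (fold-tabulate-cong (t ∘ Fin.suc) (f≈g ∘ Fin.suc))

  fold-map : ∀ (h : A → B) (L : List A) f → fold (map h L) f ≡ fold L (f ∘ h)
  fold-map h L f = ≡.cong (foldr _∙_ ε) (≡.sym (map-∘ L))

  fold-interval-ε : ∀ a k {f} → (∀ y → a ≤ y → y < a ℕ.+ k → f y ≈ ε) → fold (interval a k) f ≈ ε
  fold-interval-ε a zero    _   = refl
  fold-interval-ε a (suc k) {f} f≈ε = trans (∙-cong (f≈ε a ℕ.≤-refl (ℕ.m<m+n a z<s)) tail≈ε) (identityˡ ε)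
    where
    tail≈ε : fold (interval (suc a) k) f ≈ ε
    tail≈ε = fold-interval-ε (suc a) k (λ y a<y y< → f≈ε y (ℕ.<⇒≤ a<y) (<-+-suc a k y<))

  fold-interval-single : ∀ a k {x} {f} → a ≤ x → x < a ℕ.+ k →
                         (∀ y → a ≤ y → y < a ℕ.+ k → ¬ y ≡ x → f y ≈ ε) → fold (interval a k) f ≈ f x
  fold-interval-single a zero    a≤x x<a+0 _ = contradiction a≤x (ℕ.<⇒≱ (≡.subst (_ <_) (ℕ.+-identityʳ a) x<a+0))
  fold-interval-single a (suc k) {x} {f} a≤x x<a+1+k f≈ε with a ℕ.≟ x
  ... | yes ≡.refl = trans (∙-cong refl (fold-interval-ε (suc a) k rest≈ε)) (identityʳ _)
    where
    rest≈ε : ∀ y → suc a ≤ y → y < suc a ℕ.+ k → f y ≈ ε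
    rest≈ε y a<y y< = f≈ε y (ℕ.<⇒≤ a<y) (<-+-suc a k y<) (ℕ.>⇒≢ a<y)
  ... | no a≢x = trans (∙-cong (f≈ε a ℕ.≤-refl (ℕ.m<m+n a z<s) a≢x) rest≈f) (identityˡ _)
    where
    rest≈f : fold (interval (suc a) k) f ≈ f x
    rest≈f = fold-interval-single (suc a) k (ℕ.≤∧≢⇒< a≤x a≢x) (≡.subst (x <_) (ℕ.+-suc a k) x<a+1+k)
               (λ y a<y y< → f≈ε y (ℕ.<⇒≤ a<y) (<-+-suc a k y<))

  fold-interval-snoc : ∀ a k f → fold (interval a (suc k)) f ≈ fold (interval a k) f ∙ f (a ℕ.+ k)
  fold-interval-snoc a k f = begin
    fold (interval a (suc k)) f
      ≡⟨ ≡.cong (λ L → fold L f) (≡.trans (≡.cong (interval a) (ℕ.+-comm 1 k)) (interval-++ a k 1)) ⟩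
    fold (interval a k ++ interval (a ℕ.+ k) 1) f
      ≈⟨ fold-++ (interval a k) _ f ⟩
    fold (interval a k) f ∙ (f (a ℕ.+ k) ∙ ε)
      ≈⟨ ∙-cong refl (identityʳ _) ⟩
    fold (interval a k) f ∙ f (a ℕ.+ k)          ∎

  -- only the multiples of T survive, and each block (T d, T (d + 1)] contributes its last term
  fold-multiples : ∀ T D {g} → 0 < T → (∀ x → ¬ T ∣ x → g x ≈ ε) →
                   fold (interval 1 (T ℕ.* D)) g ≈ fold (interval 1 D) (λ y → g (T ℕ.* y))
  fold-multiples T zero    {g} _   _          rewrite ℕ.*-zeroʳ T = refl
  fold-multiples T (suc D) {g} 0<T g≈ε-off-T = begin
    fold (interval 1 (T ℕ.* suc D)) g
      ≡⟨ ≡.cong (λ L → fold L g) (≡.trans (≡.cong (interval 1) T*[1+D]≡) (interval-++ 1 TD T)) ⟩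
    fold (interval 1 TD ++ interval (1 ℕ.+ TD) T) g
      ≈⟨ fold-++ (interval 1 TD) _ g ⟩
    fold (interval 1 TD) g ∙ fold (interval (1 ℕ.+ TD) T) g
      ≈⟨ ∙-cong (fold-multiples T D 0<T g≈ε-off-T) last-block ⟩
    fold (interval 1 D) (λ y → g (T ℕ.* y)) ∙ g (T ℕ.* suc D)
      ≈⟨ fold-interval-snoc 1 D (λ y → g (T ℕ.* y)) ⟨
    fold (interval 1 (suc D)) (λ y → g (T ℕ.* y))              ∎
    where
    TD = T ℕ.* D
    T*[1+D]≡ : T ℕ.* suc D ≡ TD ℕ.+ T
    T*[1+D]≡ = ≡.trans (ℕ.*-suc T D) (ℕ.+-comm T TD)
    last-block : fold (interval (1 ℕ.+ TD) T) g ≈ g (T ℕ.* suc D)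
    last-block = fold-interval-single (1 ℕ.+ TD) T
      (≡.subst (1 ℕ.+ TD ≤_) (≡.sym T*[1+D]≡) (≡.subst (_≤ TD ℕ.+ T) (ℕ.+-comm TD 1) (ℕ.+-monoʳ-≤ TD 0<T)))
      (≡.subst (_< 1 ℕ.+ TD ℕ.+ T) (≡.sym T*[1+D]≡) ℕ.≤-refl)
      (λ y TD<y y<1+TD+T y≢ → g≈ε-off-T y (T∤ y TD<y y<1+TD+T y≢))
      where
      T∤ : ∀ y → TD < y → y < 1 ℕ.+ TD ℕ.+ T → ¬ y ≡ T ℕ.* suc D → ¬ T ∣ y
      T∤ y TD<y y<1+TD+T y≢ T∣y = contradiction (∣⇒≤ {{ℕ.>-nonZero 0<i}} T∣i) (ℕ.<⇒≱ i<T)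
        where
        i = y ℕ.∸ TD
        y≡TD+i : y ≡ TD ℕ.+ i
        y≡TD+i = ≡.sym (ℕ.m+[n∸m]≡n (ℕ.<⇒≤ TD<y))
        0<i : 0 < i
        0<i = ℕ.m<n⇒0<n∸m TD<y
        i<T : i < T
        i<T = ℕ.+-cancelˡ-< TD i T (≡.subst (_< TD ℕ.+ T) y≡TD+i
                (ℕ.≤∧≢⇒< (ℕ.≤-pred y<1+TD+T) (λ y≡ → y≢ (≡.trans y≡ (≡.sym T*[1+D]≡)))))
        T∣i : T ∣ i
        T∣i = ∣m+n∣m⇒∣n (≡.subst (T ∣_) y≡TD+i T∣y) (∣m⇒∣m*n D ∣-refl)

  if-dec-congʳ : ∀ {P : Set p} (P? : Dec P) {x y z} → (¬ P → x ≈ y) →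
                 (if does P? then z else x) ≈ (if does P? then z else y)
  if-dec-congʳ (yes _) _   = refl
  if-dec-congʳ (no ¬p) x≈y = x≈y ¬p

  fold-divisors : ∀ n f → fold (divisors n) f ≈ fold (interval 1 n) (λ d → if does (d ∣? n) then f d else ε)
  fold-divisors n f = trans (fold-filter (_∣? n) (range 1 n) f)
    (reflexive (≡.cong (λ L → fold L (λ d → if does (d ∣? n) then f d else ε)) (range-1 n)))

  fold-divisors-cong : ∀ n {f g} → (∀ {d} → d ∣ n → f d ≈ g d) → fold (divisors n) f ≈ fold (divisors n) g
  fold-divisors-cong n {f} {g} f≈g =
    trans (fold-divisors n f) (trans (fold-cong (interval 1 n) on-divisors) (sym (fold-divisors n g)))
    where
    on-divisors : ∀ d → (if does (d ∣? n) then f d else ε) ≈ (if does (d ∣? n) then g d else ε)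
    on-divisors d with d ∣? n
    ... | yes d∣n = f≈g d∣n
    ... | no  _   = refl

  fold-divisors-single : ∀ {n d₀} {f} → 0 < n → d₀ ∣ n → (∀ {d} → d ∣ n → ¬ d ≡ d₀ → f d ≈ ε) →
                         fold (divisors n) f ≈ f d₀
  fold-divisors-single {n} {d₀} {f} 0<n d₀∣n f≈ε = trans (fold-divisors n f)
    (trans (fold-interval-single 1 n (∣-pos 0<n d₀∣n) (ℕ.s≤s (∣⇒≤ {{ℕ.>-nonZero 0<n}} d₀∣n)) off-d₀) at-d₀)
    where
    off-d₀ : ∀ d → 1 ≤ d → d < 1 ℕ.+ n → ¬ d ≡ d₀ → (if does (d ∣? n) then f d else ε) ≈ ε
    off-d₀ d _ _ d≢d₀ with d ∣? n
    ... | yes d∣n = f≈ε d∣n d≢d₀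
    ... | no  _   = refl
    at-d₀ : (if does (d₀ ∣? n) then f d₀ else ε) ≈ f d₀
    at-d₀ with d₀ ∣? n
    ... | yes _    = refl
    ... | no  d₀∤n = contradiction d₀∣n d₀∤n

module CommutativeFolds {c ℓ : Level} (M : CommutativeMonoid c ℓ) where
  open CommutativeMonoid M
  open Folds monoid public
  open import Algebra.Properties.CommutativeSemigroup commutativeSemigroup using (interchange)

  fold-∙ : ∀ (L : List A) f g → fold L (λ x → f x ∙ g x) ≈ fold L f ∙ fold L g
  fold-∙ []      f g = sym (identityˡ ε)
  fold-∙ (x ∷ L) f g = trans (∙-cong refl (fold-∙ L f g)) (interchange _ _ _ _)

  fold-comm : ∀ (L : List A) (L′ : List B) (f : A → B → Carrier) →
              fold L (λ x → fold L′ (f x)) ≈ fold L′ (λ y → fold L (λ x → f x y))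
  fold-comm []      L′ f = sym (fold-ε L′ (λ _ → refl))
  fold-comm (x ∷ L) L′ f = trans (∙-cong refl (fold-comm L L′ f)) (sym (fold-∙ L′ (f x) _))

  fold-divisors-remove : ∀ {n d₀} f → 0 < n → d₀ ∣ n →
                         fold (divisors n) f ≈ f d₀ ∙ fold (divisors n) (λ d → if does (d ℕ.≟ d₀) then ε else f d)
  fold-divisors-remove {n} {d₀} f 0<n d₀∣n = begin
    fold (divisors n) f                     ≈⟨ fold-cong (divisors n) split ⟩
    fold (divisors n) (λ d → on d ∙ off d)  ≈⟨ fold-∙ (divisors n) on off ⟩
    fold (divisors n) on ∙ fold (divisors n) off ≈⟨ ∙-cong (fold-divisors-single 0<n d₀∣n on-elsewhere) refl ⟩
    on d₀ ∙ fold (divisors n) off           ≈⟨ ∙-cong at-d₀ refl ⟩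
    f d₀ ∙ fold (divisors n) off            ∎
    where
    open import Relation.Binary.Reasoning.Setoid setoid
    on off : ℕ → Carrier
    on  d = if does (d ℕ.≟ d₀) then f d else ε
    off d = if does (d ℕ.≟ d₀) then ε else f d
    split : ∀ d → f d ≈ on d ∙ off d
    split d with does (d ℕ.≟ d₀)
    ... | true  = sym (identityʳ _)
    ... | false = sym (identityˡ _)
    on-elsewhere : ∀ {d} → d ∣ n → ¬ d ≡ d₀ → on d ≈ ε
    on-elsewhere {d} _ d≢d₀ = reflexive (if-dec-no (d ℕ.≟ d₀) d≢d₀)
    at-d₀ : on d₀ ≈ f d₀
    at-d₀ = reflexive (if-dec-yes (d₀ ℕ.≟ d₀) ≡.refl)

module RingSums {c ℓ : Level} (R : CommutativeRing c ℓ) where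
  open CommutativeRing R
  open import Relation.Binary.Reasoning.Setoid setoid
  import Algebra.Properties.Semiring.Exp semiring as Exp
  open import Algebra.Properties.Group +-group using (x∙y⁻¹≈ε⇒x≈y; x≈y⇒x∙y⁻¹≈ε; ∙-cancelʳ)
  open import Algebra.Properties.RingWithoutOne (Ring.ringWithoutOne ring) using ([y-z]x≈yx-zx)
  open import Algebra.Properties.CommutativeSemigroup *-commutativeSemigroup using (interchange)

  module Σ = CommutativeFolds +-commutativeMonoid
  module Π = CommutativeFolds *-commutativeMonoid

  Σ : List A → (A → Carrier) → Carrier
  Σ = Σ.fold

  Π : List A → (A → Carrier) → Carrier
  Π = Π.fold

  𝟙 : {P : Set p} → Dec P → Carrier
  𝟙 P? = if does P? then 1# else 0#

  𝟙-yes : {P : Set p} (P? : Dec P) → P → 𝟙 P? ≈ 1#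
  𝟙-yes (yes _) _ = refl
  𝟙-yes (no ¬p) p = contradiction p ¬p

  𝟙-no : {P : Set p} (P? : Dec P) → ¬ P → 𝟙 P? ≈ 0#
  𝟙-no (yes p) ¬p = contradiction p ¬p
  𝟙-no (no _)  _  = refl

  𝟙-cong : {P : Set p} {Q : Set q} (P? : Dec P) (Q? : Dec Q) → P ⇔ Q → 𝟙 P? ≈ 𝟙 Q?
  𝟙-cong P? (yes q) P⇔Q = 𝟙-yes P? (Equivalence.from P⇔Q q)
  𝟙-cong P? (no ¬q) P⇔Q = 𝟙-no P? (λ p → ¬q (Equivalence.to P⇔Q p))

  𝟙-guard : {P : Set p} (P? : Dec P) {x y : Carrier} → (P → x ≈ y) → 𝟙 P? * x ≈ 𝟙 P? * y
  𝟙-guard (yes p) x≈y = *-cong refl (x≈y p)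
  𝟙-guard (no _)  _   = trans (zeroˡ _) (sym (zeroˡ _))

  𝟙-×-dec : {P : Set p} {Q : Set q} (P? : Dec P) (Q? : Dec Q) → 𝟙 (P? ×-dec Q?) ≈ 𝟙 P? * 𝟙 Q?
  𝟙-×-dec (yes _) Q? = sym (*-identityˡ _)
  𝟙-×-dec (no _)  Q? = sym (zeroˡ _)

  *-distribˡ-Σ : ∀ k (L : List A) f → k * Σ L f ≈ Σ L (λ x → k * f x)
  *-distribˡ-Σ k []      f = zeroʳ k
  *-distribˡ-Σ k (x ∷ L) f = trans (distribˡ k _ _) (+-cong refl (*-distribˡ-Σ k L f))

  *-distribʳ-Σ : ∀ k (L : List A) f → Σ L f * k ≈ Σ L (λ x → f x * k)
  *-distribʳ-Σ k L f = trans (*-comm _ k) (trans (*-distribˡ-Σ k L f) (Σ.fold-cong L (λ x → *-comm k (f x))))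

  Σ-filter : ∀ {P : Pred A p} (P? : Decidable P) L f → Σ (filter P? L) f ≈ Σ L (λ x → 𝟙 (P? x) * f x)
  Σ-filter P? L f = trans (Σ.fold-filter P? L f) (Σ.fold-cong L select)
    where
    select : ∀ x → (if does (P? x) then f x else 0#) ≈ 𝟙 (P? x) * f x
    select x with does (P? x)
    ... | true  = sym (*-identityˡ _)
    ... | false = sym (zeroˡ _)

  natR-length-filter : ∀ {P : Pred A p} (P? : Decidable P) L → natR R (length (filter P? L)) ≈ Σ L (λ x → 𝟙 (P? x))
  natR-length-filter P? []      = refl
  natR-length-filter P? (x ∷ L) with does (P? x)
  ... | true  = +-cong refl (natR-length-filter P? L)
  ... | false = trans (natR-length-filter P? L) (sym (+-identityˡ _))

  Σ-interval-1# : ∀ a M → Σ (interval a M) (λ _ → 1#) ≈ natR R M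
  Σ-interval-1# a zero    = refl
  Σ-interval-1# a (suc M) = +-cong refl (Σ-interval-1# (suc a) M)

  pow≡^ : ∀ x k → pow R x k ≡ x Exp.^ k
  pow≡^ x zero    = ≡.refl
  pow≡^ x (suc k) = ≡.cong (x *_) (pow≡^ x k)

  pow-cong : ∀ {x y} k → x ≈ y → pow R x k ≈ pow R y k
  pow-cong {x} {y} k x≈y rewrite pow≡^ x k | pow≡^ y k = Exp.^-congˡ k x≈y

  pow-+ : ∀ x m n → pow R x (m ℕ.+ n) ≈ pow R x m * pow R x n
  pow-+ x m n rewrite pow≡^ x (m ℕ.+ n) | pow≡^ x m | pow≡^ x n = Exp.^-homo-* x m n

  pow-* : ∀ x m n → pow R x (m ℕ.* n) ≈ pow R (pow R x m) n
  pow-* x m n rewrite pow≡^ x (m ℕ.* n) | pow≡^ (pow R x m) n | pow≡^ x m = sym (Exp.^-assocʳ x m n)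

  pow-1# : ∀ k → pow R 1# k ≈ 1#
  pow-1# zero    = refl
  pow-1# (suc k) = trans (*-identityˡ _) (pow-1# k)

  Σ-powers-shift : ∀ w a M → Σ (interval (suc a) M) (pow R w) ≈ w * Σ (interval a M) (pow R w)
  Σ-powers-shift w a zero    = sym (zeroʳ w)
  Σ-powers-shift w a (suc M) = trans (+-cong refl (Σ-powers-shift w (suc a) M)) (sym (distribˡ w _ _))

  Σ-powers-of-root-of-unity : IsIntegralDomain R → ∀ {w} M → pow R w M ≈ 1# → ¬ w ≈ 1# →
                              Σ (interval 1 M) (pow R w) ≈ 0#
  Σ-powers-of-root-of-unity (_ , no-zero-divisors) {w} M w^M≈1 w≉1
    with no-zero-divisors (w - 1#) S [w-1]S≈0
    where
    S = Σ (interval 1 M) (pow R w)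
    -- w S + w and S + w^(M+1) are both the sum of w^1, …, w^(M+1)
    geometric : w * S + w ≈ S + pow R w (suc M)
    geometric = begin
      w * S + w                           ≈⟨ +-cong (sym (Σ-powers-shift w 1 M)) (sym (*-identityʳ w)) ⟩
      Σ (interval 2 M) (pow R w) + pow R w 1 ≈⟨ +-comm _ _ ⟩
      Σ (interval 1 (suc M)) (pow R w)    ≈⟨ Σ.fold-interval-snoc 1 M (pow R w) ⟩
      S + pow R w (suc M)                 ∎
    wS≈S : w * S ≈ S
    wS≈S = ∙-cancelʳ w _ _ (trans geometric (+-cong refl (trans (*-cong refl w^M≈1) (*-identityʳ w))))
    [w-1]S≈0 : (w - 1#) * S ≈ 0#
    [w-1]S≈0 = trans ([y-z]x≈yx-zx S w 1#) (x≈y⇒x∙y⁻¹≈ε (trans wS≈S (sym (*-identityˡ S))))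
  ... | inj₁ w-1≈0 = contradiction (x∙y⁻¹≈ε⇒x≈y w 1# w-1≈0) w≉1
  ... | inj₂ S≈0   = S≈0

  Σ-tuples : ∀ {Q : ℕ → ℕ → Set q} (Q? : ∀ x y → Dec (Q x y)) (L : List ℕ) (g : ℕ → Carrier) {k} (ys : Vec ℕ k) →
             Σ (tuples k L) (λ xs → 𝟙 (All.all? (λ xy → Q? (proj₁ xy) (proj₂ xy)) (Vec.zip xs ys))
                                    * Π (Vec.toList xs) g)
             ≈ Π (Vec.toList ys) (λ y → Σ L (λ x → 𝟙 (Q? x y) * g x))
  Σ-tuples Q? L g []       = trans (+-identityʳ _) (*-identityˡ _)
  Σ-tuples {Q = Q} Q? L g {suc k} (y ∷ ys) = begin
    Σ (tuples (suc k) L) φ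
      ≈⟨ Σ.fold-concatMap L (λ x → map (x ∷_) (tuples k L)) φ ⟩
    Σ L (λ x → Σ (map (x ∷_) (tuples k L)) φ)
      ≈⟨ Σ.fold-cong L (λ x → reflexive (Σ.fold-map (x ∷_) (tuples k L) φ)) ⟩
    Σ L (λ x → Σ (tuples k L) (λ xs → φ (x ∷ xs)))
      ≈⟨ Σ.fold-cong L (λ x → Σ.fold-cong (tuples k L) (λ xs → split x xs)) ⟩
    Σ L (λ x → Σ (tuples k L) (λ xs → α x * β xs))
      ≈⟨ Σ.fold-cong L (λ x → *-distribˡ-Σ (α x) (tuples k L) β) ⟨
    Σ L (λ x → α x * Σ (tuples k L) β)
      ≈⟨ *-distribʳ-Σ _ L α ⟨
    Σ L α * Σ (tuples k L) β
      ≈⟨ *-cong refl (Σ-tuples Q? L g ys) ⟩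
    Σ L α * Π (Vec.toList ys) (λ y → Σ L (λ x → 𝟙 (Q? x y) * g x)) ∎
    where
    all? : ∀ {j} (xs ys : Vec ℕ j) → Dec (All (λ xy → Q (proj₁ xy) (proj₂ xy)) (Vec.zip xs ys))
    all? xs ys = All.all? (λ xy → Q? (proj₁ xy) (proj₂ xy)) (Vec.zip xs ys)
    φ : Vec ℕ (suc k) → Carrier
    φ xs = 𝟙 (all? xs (y ∷ ys)) * Π (Vec.toList xs) g
    α : ℕ → Carrier
    α x = 𝟙 (Q? x y) * g x
    β : Vec ℕ k → Carrier
    β xs = 𝟙 (all? xs ys) * Π (Vec.toList xs) g
    split : ∀ x xs → φ (x ∷ xs) ≈ α x * β xs
    split x xs = trans (*-cong (𝟙-×-dec (Q? x y) (all? xs ys)) refl) (interchange _ _ _ _)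

  pow-length-filter-∷ : ∀ {P : Pred A p} (P? : Decidable P) x y L →
                        pow R x (length (filter P? (y ∷ L)))
                        ≈ (if does (P? y) then x else 1#) * pow R x (length (filter P? L))
  pow-length-filter-∷ P? x y L with does (P? y)
  ... | true  = refl
  ... | false = sym (*-identityˡ _)

  Π-multiplicities : ∀ {n} → 0 < n → ∀ {k} (t : Fin k → ℕ) → (∀ i → t i ∣ n) → (h : ℕ → Carrier) →
                     Π (Vec.toList (Vec.tabulate t)) h ≈ Π (divisors n) (λ d → pow R (h d) (multiplicity k t d))
  Π-multiplicities {n} 0<n {zero}  t _   h = sym (Π.fold-ε (divisors n) (λ _ → refl))
  Π-multiplicities {n} 0<n {suc k} t t∣n h = begin
    h t₀ * Π (Vec.toList (Vec.tabulate t′)) h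
      ≈⟨ *-cong (sym only-t₀) (Π-multiplicities 0<n t′ (t∣n ∘ Fin.suc) h) ⟩
    Π (divisors n) at-t₀ * Π (divisors n) (λ d → pow R (h d) (multiplicity k t′ d))
      ≈⟨ Π.fold-∙ (divisors n) at-t₀ _ ⟨
    Π (divisors n) (λ d → at-t₀ d * pow R (h d) (multiplicity k t′ d))
      ≈⟨ Π.fold-cong (divisors n) (λ d → pow-length-filter-∷ (ℕ._≟ d) (h d) t₀ _) ⟨
    Π (divisors n) (λ d → pow R (h d) (multiplicity (suc k) t d))               ∎
    where
    t₀ = t Fin.zero
    t′ = t ∘ Fin.suc
    at-t₀ : ℕ → Carrier
    at-t₀ d = if does (t₀ ℕ.≟ d) then h d else 1#
    only-t₀ : Π (divisors n) at-t₀ ≈ h t₀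
    only-t₀ = trans (Π.fold-divisors-single 0<n (t∣n Fin.zero)
                      (λ {d} _ d≢t₀ → reflexive (if-dec-no (t₀ ℕ.≟ d) (d≢t₀ ∘ ≡.sym))))
                    (reflexive (if-dec-yes (t₀ ℕ.≟ t₀) ≡.refl))

module AdditiveCharacter {c ℓ : Level} (R : CommutativeRing c ℓ) (ζ : CommutativeRing.Carrier R)
                         (N : ℕ) .{{_ : NonZero N}} (ζ-primitive : IsPrimitiveRoot R ζ N) where
  open CommutativeRing R
  open RingSums R
  open IntegerResidues
  open import Relation.Binary.Reasoning.Setoid setoid
  open import Data.Nat.DivMod using (_%_; _/_; m≡m%n+[m/n]*n)
  open import Data.Integer.Tactic.RingSolver using (solve-∀)

  E : ℤ → Carrier
  E a = pow R ζ (a %ℕ N)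

  E-cong : ∀ a b → + N ∣ℤ a ℤ.- b → E a ≡ E b
  E-cong a b N∣a-b = ≡.cong (pow R ζ) (%ℕ-cong N {a} {b} N∣a-b)

  pow-ζ-% : ∀ p → pow R ζ p ≈ pow R ζ (p % N)
  pow-ζ-% p = begin
    pow R ζ p
      ≡⟨ ≡.cong (pow R ζ) (m≡m%n+[m/n]*n p N) ⟩
    pow R ζ (p % N ℕ.+ p / N ℕ.* N)
      ≈⟨ pow-+ ζ (p % N) (p / N ℕ.* N) ⟩
    pow R ζ (p % N) * pow R ζ (p / N ℕ.* N)
      ≡⟨ ≡.cong (λ k → pow R ζ (p % N) * pow R ζ k) (ℕ.*-comm (p / N) N) ⟩
    pow R ζ (p % N) * pow R ζ (N ℕ.* (p / N))
      ≈⟨ *-cong refl (pow-* ζ N (p / N)) ⟩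
    pow R ζ (p % N) * pow R (pow R ζ N) (p / N)
      ≈⟨ *-cong refl (trans (pow-cong (p / N) (proj₁ ζ-primitive)) (pow-1# (p / N))) ⟩
    pow R ζ (p % N) * 1#
      ≈⟨ *-identityʳ _ ⟩
    pow R ζ (p % N)                             ∎

  E-+ℕ : ∀ p → E (+ p) ≈ pow R ζ p
  E-+ℕ p = sym (pow-ζ-% p)

  E-+ : ∀ a b → E (a ℤ.+ b) ≈ E a * E b
  E-+ a b = begin
    E (a ℤ.+ b)           ≡⟨ E-cong (a ℤ.+ b) (+ (ra ℕ.+ rb)) (divides (qa ℤ.+ qb) difference) ⟩
    E (+ (ra ℕ.+ rb))     ≈⟨ E-+ℕ (ra ℕ.+ rb) ⟩
    pow R ζ (ra ℕ.+ rb)   ≈⟨ pow-+ ζ ra rb ⟩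
    E a * E b             ∎
    where
    ra = a %ℕ N
    rb = b %ℕ N
    qa = a /ℕ N
    qb = b /ℕ N
    regroup : ∀ ra rb qa qb n → ((ra ℤ.+ qa ℤ.* n) ℤ.+ (rb ℤ.+ qb ℤ.* n)) ℤ.- (ra ℤ.+ rb) ≡ (qa ℤ.+ qb) ℤ.* n
    regroup = solve-∀
    difference : (a ℤ.+ b) ℤ.- + (ra ℕ.+ rb) ≡ (qa ℤ.+ qb) ℤ.* + N
    difference = ≡.trans (≡.cong₂ (λ x y → x ℤ.- y) (≡.cong₂ ℤ._+_ (a≡a%ℕn+[a/ℕn]*n a N) (a≡a%ℕn+[a/ℕn]*n b N))
                                                       (ℤ.pos-+ ra rb))
                         (regroup (+ ra) (+ rb) qa qb (+ N))

  E≈1⇔∣ : ∀ a → E a ≈ 1# ⇔ + N ∣ℤ a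
  E≈1⇔∣ a = mk⇔ to (λ N∣a → reflexive (≡.cong (pow R ζ) (Equivalence.to (∣⇔%ℕ≡0 N) N∣a)))
    where
    to : E a ≈ 1# → + N ∣ℤ a
    to E≈1 with a %ℕ N in r≡
    ... | zero  = Equivalence.from (∣⇔%ℕ≡0 N) r≡
    ... | suc r = contradiction E≈1 (proj₂ ζ-primitive (suc r) z<s (≡.subst (ℕ._< N) r≡ (n%ℕd<d a N)))

  E-*ℕ : ∀ z a → E (+ z ℤ.* a) ≈ pow R (E a) z
  E-*ℕ zero    a = Equivalence.from (E≈1⇔∣ (+ 0)) (divides (+ 0) ≡.refl)
  E-*ℕ (suc z) a = begin
    E (+ suc z ℤ.* a)       ≡⟨ ≡.cong E (≡.trans (≡.cong (ℤ._* a) (ℤ.pos-+ 1 z)) (unfold (+ z) a)) ⟩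
    E (a ℤ.+ + z ℤ.* a)     ≈⟨ E-+ a (+ z ℤ.* a) ⟩
    E a * E (+ z ℤ.* a)     ≈⟨ *-cong refl (E-*ℕ z a) ⟩
    pow R (E a) (suc z)     ∎
    where
    unfold : ∀ z a → (ℤ.1ℤ ℤ.+ z) ℤ.* a ≡ a ℤ.+ z ℤ.* a
    unfold = solve-∀

  E-scaled : ∀ {T D} .{{_ : NonZero D}} → N ≡ T ℕ.* D → ∀ a → pow R ζ (T ℕ.* (a %ℕ D)) ≈ E (+ T ℤ.* a)
  E-scaled {T} {D} N≡T*D a = begin
    pow R ζ (T ℕ.* r)        ≈⟨ E-+ℕ (T ℕ.* r) ⟨
    E (+ (T ℕ.* r))          ≡⟨ E-cong (+ (T ℕ.* r)) (+ T ℤ.* a) (divides (ℤ.- (a /ℕ D)) difference) ⟩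
    E (+ T ℤ.* a)            ∎
    where
    r = a %ℕ D
    regroup : ∀ T r q D → T ℤ.* r ℤ.- T ℤ.* (r ℤ.+ q ℤ.* D) ≡ (ℤ.- q) ℤ.* (T ℤ.* D)
    regroup = solve-∀
    difference : + (T ℕ.* r) ℤ.- + T ℤ.* a ≡ (ℤ.- (a /ℕ D)) ℤ.* + N
    difference = ≡.trans (≡.cong₂ (λ x y → x ℤ.- + T ℤ.* y) (ℤ.pos-* T r) (a≡a%ℕn+[a/ℕn]*n a D))
                 (≡.trans (regroup (+ T) (+ r) (a /ℕ D) (+ D))
                          (≡.cong ((ℤ.- (a /ℕ D)) ℤ.*_) (≡.trans (≡.sym (ℤ.pos-* T D)) (≡.cong +_ (≡.sym N≡T*D)))))

  Σ-E-∣ : ∀ {a} M → + N ∣ℤ a → Σ (interval 1 M) (λ z → E (+ z ℤ.* a)) ≈ natR R M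
  Σ-E-∣ M N∣a = trans (Σ.fold-cong (interval 1 M) (λ z → Equivalence.from (E≈1⇔∣ _) (∣n⇒∣m*n (+ z) N∣a)))
                      (Σ-interval-1# 1 M)

  Σ-E-∤ : IsIntegralDomain R → ∀ {a} M → ¬ (+ N ∣ℤ a) → + N ∣ℤ + M ℤ.* a →
          Σ (interval 1 M) (λ z → E (+ z ℤ.* a)) ≈ 0#
  Σ-E-∤ domain {a} M N∤a N∣Ma = trans (Σ.fold-cong (interval 1 M) (λ z → E-*ℕ z a))
    (Σ-powers-of-root-of-unity domain M (trans (sym (E-*ℕ M a)) (Equivalence.from (E≈1⇔∣ _) N∣Ma))
                               (λ Ea≈1 → N∤a (Equivalence.to (E≈1⇔∣ a) Ea≈1)))

module ClassSums {c ℓ : Level} (R : CommutativeRing c ℓ) (domain : IsIntegralDomain R)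
                 (s n : ℕ) (0<s : 0 < s) (0<n : 0 < n)
                 (ζ : CommutativeRing.Carrier R) (ζ-primitive : IsPrimitiveRoot R ζ (n ^ s)) where
  open CommutativeRing R
  open RingSums R
  open Arithmetic
  open DivisorClasses s n 0<s 0<n
  open IntegerResidues
  open import Relation.Binary.Reasoning.Setoid setoid
  open import Algebra.Properties.Group +-group using (∙-cancelʳ)
  open import Data.Integer.Tactic.RingSolver using (solve-∀)

  instance
    N≢0 : NonZero N
    N≢0 = ℕ.>-nonZero 0<N

  open AdditiveCharacter R ζ N ζ-primitive public

  classSum : ℕ → ℤ → Carrier
  classSum t c = Σ (interval 1 N) (λ x → 𝟙 (gcdS s x N ℕ.≟ t ^ s) * E (c ℤ.* + x))

  multipleSum : ℕ → ℤ → Carrier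
  multipleSum u c = Σ (interval 1 N) (λ x → 𝟙 (u ^ s ∣? x) * E (c ℤ.* + x))

  gcdS≡⇒^∣ : ∀ {x t} → gcdS s x N ≡ t ^ s → t ^ s ∣ x
  gcdS≡⇒^∣ {x} gcdS≡t^s = ≡.subst (_∣ x) gcdS≡t^s (gcdRoot^∣ˡ s 0<s 0<N x)

  classSum≈cohen : ∀ {t} c → t ∣ n → classSum t c ≈ cohen R ζ N (divN n t) s c
  classSum≈cohen {t} c t∣n = begin
    classSum t c
      ≡⟨ ≡.cong (λ M → Σ (interval 1 M) g) N≡T*D ⟩
    Σ (interval 1 (T ℕ.* D)) g
      ≈⟨ Σ.fold-multiples T D 0<T g-off-multiples ⟩
    Σ (interval 1 D) (λ y → g (T ℕ.* y))
      ≈⟨ Σ.fold-cong (interval 1 D) (λ y → *-cong (𝟙-cong (gcdS s (T ℕ.* y) N ℕ.≟ T) (coprime? y) (scaled-class y))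
                                                    (sym (term y))) ⟩
    Σ (interval 1 D) (λ j → 𝟙 (coprime? j) * e j)
      ≡⟨ ≡.cong (λ L → Σ L (λ j → 𝟙 (coprime? j) * e j)) (range-1 D) ⟨
    Σ (range 1 D) (λ j → 𝟙 (coprime? j) * e j)
      ≈⟨ Σ-filter coprime? (range 1 D) e ⟨
    cohen R ζ N (divN n t) s c                     ∎
    where
    T D : ℕ
    T = t ^ s
    D = divN n t ^ s
    0<T : 0 < T
    0<T = ℕ.m^n>0 t {{ℕ.>-nonZero (∣-pos 0<n t∣n)}} s
    instance
      D≢0 : NonZero D
      D≢0 = ℕ.m^n≢0 (divN n t) s {{ℕ.>-nonZero (∣-pos 0<n (divN-∣ t∣n))}}
    N≡T*D : N ≡ T ℕ.* D
    N≡T*D = ≡.trans (≡.cong (_^ s) (m∣n⇒n≡m*divN t∣n)) (^-distribʳ-* s t (divN n t))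
    g : ℕ → Carrier
    g x = 𝟙 (gcdS s x N ℕ.≟ T) * E (c ℤ.* + x)
    coprime? : ∀ j → Dec (gcdS s j D ≡ 1)
    coprime? j = gcdS s j D ℕ.≟ 1
    e : ℕ → Carrier
    e j = pow R ζ (divN N D ℕ.* modZ (c ℤ.* + j) D)
    g-off-multiples : ∀ x → ¬ T ∣ x → g x ≈ 0#
    g-off-multiples x T∤x = trans (*-cong (𝟙-no (gcdS s x N ℕ.≟ T) (T∤x ∘ gcdS≡⇒^∣)) refl) (zeroˡ _)
    scaled-class : ∀ y → gcdS s (T ℕ.* y) N ≡ T ⇔ gcdS s y D ≡ 1
    scaled-class y = ⇔.trans (gcdS≡^⇔gcdRoot≡ s 0<s 0<N (T ℕ.* y) t)
                    (⇔.trans (classOf-scale t∣n y)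
                             (⇔.sym (≡.subst (λ one → gcdS s y D ≡ one ⇔ gcdRoot s y D ≡ 1) (ℕ.^-zeroˡ s)
                                              (gcdS≡^⇔gcdRoot≡ s 0<s (ℕ.m^n>0 (divN n t) {{ℕ.>-nonZero (∣-pos 0<n (divN-∣ t∣n))}} s) y 1))))
    N/D≡T : divN N D ≡ T
    N/D≡T = ≡.trans (divN-^ s 0<n (divN-∣ t∣n)) (≡.cong (_^ s) (divN-involutive 0<n t∣n))
    term : ∀ y → e y ≈ E (c ℤ.* + (T ℕ.* y))
    term y = begin
      e y
        ≡⟨ ≡.cong₂ (λ a r → pow R ζ (a ℕ.* r)) N/D≡T (modZ≡%ℕ (c ℤ.* + y) D) ⟩
      pow R ζ (T ℕ.* ((c ℤ.* + y) %ℕ D))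
        ≈⟨ E-scaled {T} {D} N≡T*D (c ℤ.* + y) ⟩
      E (+ T ℤ.* (c ℤ.* + y))
        ≡⟨ ≡.cong E (≡.trans (reorder (+ T) c (+ y)) (≡.cong (c ℤ.*_) (≡.sym (ℤ.pos-* T y)))) ⟩
      E (c ℤ.* + (T ℕ.* y))                  ∎
      where
      reorder : ∀ T c y → T ℤ.* (c ℤ.* y) ≡ c ℤ.* (T ℤ.* y)
      reorder = solve-∀

  module _ {u : ℕ} (u∣n : u ∣ n) where
    private
      U M : ℕ
      U = u ^ s
      M = divN n u ^ s
      N≡U*M : N ≡ U ℕ.* M
      N≡U*M = ≡.trans (≡.cong (_^ s) (m∣n⇒n≡m*divN u∣n)) (^-distribʳ-* s u (divN n u))
      0<U : 0 < U
      0<U = ℕ.m^n>0 u {{ℕ.>-nonZero (∣-pos 0<n u∣n)}} s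

    multipleSum≈Σ-E : ∀ c → multipleSum u c ≈ Σ (interval 1 M) (λ z → E (+ z ℤ.* (+ U ℤ.* c)))
    multipleSum≈Σ-E c = begin
      multipleSum u c
        ≡⟨ ≡.cong (λ K → Σ (interval 1 K) g) N≡U*M ⟩
      Σ (interval 1 (U ℕ.* M)) g
        ≈⟨ Σ.fold-multiples U M 0<U (λ x U∤x → trans (*-cong (𝟙-no (U ∣? x) U∤x) refl) (zeroˡ _)) ⟩
      Σ (interval 1 M) (λ z → g (U ℕ.* z))
        ≈⟨ Σ.fold-cong (interval 1 M) multiple ⟩
      Σ (interval 1 M) (λ z → E (+ z ℤ.* (+ U ℤ.* c))) ∎
      where
      g = λ x → 𝟙 (U ∣? x) * E (c ℤ.* + x)
      reorder : ∀ c U z → c ℤ.* (U ℤ.* z) ≡ z ℤ.* (U ℤ.* c)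
      reorder = solve-∀
      multiple : ∀ z → g (U ℕ.* z) ≈ E (+ z ℤ.* (+ U ℤ.* c))
      multiple z = trans (*-cong (𝟙-yes (U ∣? U ℕ.* z) (m∣m*n z)) refl)
                         (trans (*-identityˡ _)
                                (reflexive (≡.cong E (≡.trans (≡.cong (c ℤ.*_) (ℤ.pos-* U z)) (reorder c (+ U) (+ z))))))

    multipleSum-invariant : ∀ {c c′} → (+ N ∣ℤ + U ℤ.* c ⇔ + N ∣ℤ + U ℤ.* c′) → multipleSum u c ≈ multipleSum u c′
    multipleSum-invariant {c} {c′} N∣Uc⇔N∣Uc′ with + N ∣ℤ? + U ℤ.* c
    ... | yes N∣Uc = begin
      multipleSum u c   ≈⟨ trans (multipleSum≈Σ-E c) (Σ-E-∣ M N∣Uc) ⟩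
      natR R M          ≈⟨ trans (multipleSum≈Σ-E c′) (Σ-E-∣ M (Equivalence.to N∣Uc⇔N∣Uc′ N∣Uc)) ⟨
      multipleSum u c′  ∎
    ... | no N∤Uc = begin
      multipleSum u c
        ≈⟨ trans (multipleSum≈Σ-E c) (Σ-E-∤ domain M N∤Uc (N∣MUc c)) ⟩
      0#
        ≈⟨ trans (multipleSum≈Σ-E c′)
                 (Σ-E-∤ domain M (N∤Uc ∘ Equivalence.from N∣Uc⇔N∣Uc′) (N∣MUc c′)) ⟨
      multipleSum u c′  ∎
      where
      reorder : ∀ M U c → M ℤ.* (U ℤ.* c) ≡ c ℤ.* (U ℤ.* M)
      reorder = solve-∀
      N∣MUc : ∀ c → + N ∣ℤ + M ℤ.* (+ U ℤ.* c)
      N∣MUc c = divides c (≡.trans (reorder (+ M) (+ U) c)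
                                   (≡.cong (c ℤ.*_) (≡.trans (≡.sym (ℤ.pos-* U M)) (≡.cong +_ (≡.sym N≡U*M)))))

    𝟙-multiple≈Σ-classes : ∀ x → 𝟙 (U ∣? x) ≈ Σ (divisors n) (λ v → 𝟙 (u ∣? v) * 𝟙 (gcdS s x N ℕ.≟ v ^ s))
    𝟙-multiple≈Σ-classes x = sym (trans (Σ.fold-divisors-single 0<n (classOf∣n x) other-classes) at-class)
      where
      other-classes : ∀ {v} → v ∣ n → ¬ v ≡ classOf x → 𝟙 (u ∣? v) * 𝟙 (gcdS s x N ℕ.≟ v ^ s) ≈ 0#
      other-classes {v} _ v≢r = trans (*-cong refl (𝟙-no (gcdS s x N ℕ.≟ v ^ s)
                                  (λ eq → v≢r (≡.sym (Equivalence.to (gcdS≡^⇔gcdRoot≡ s 0<s 0<N x v) eq))))) (zeroʳ _)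
      at-class : 𝟙 (u ∣? classOf x) * 𝟙 (gcdS s x N ℕ.≟ classOf x ^ s) ≈ 𝟙 (U ∣? x)
      at-class = trans (*-cong refl (𝟙-yes (gcdS s x N ℕ.≟ classOf x ^ s) ≡.refl))
                       (trans (*-identityʳ _) (𝟙-cong (u ∣? classOf x) (U ∣? x) (∣classOf⇔ x u∣n)))

    multipleSum≈Σ-classSum : ∀ c → multipleSum u c ≈ Σ (divisors n) (λ v → 𝟙 (u ∣? v) * classSum v c)
    multipleSum≈Σ-classSum c = begin
      multipleSum u c
        ≈⟨ Σ.fold-cong I (λ x → *-cong (𝟙-multiple≈Σ-classes x) refl) ⟩
      Σ I (λ x → Σ D (λ v → u∣ v * inClass x v) * χ x)
        ≈⟨ Σ.fold-cong I (λ x → *-distribʳ-Σ (χ x) D _) ⟩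
      Σ I (λ x → Σ D (λ v → u∣ v * inClass x v * χ x))
        ≈⟨ Σ.fold-comm I D _ ⟩
      Σ D (λ v → Σ I (λ x → u∣ v * inClass x v * χ x))
        ≈⟨ Σ.fold-cong D (λ v → trans (Σ.fold-cong I (λ x → *-assoc _ _ _)) (sym (*-distribˡ-Σ (u∣ v) I _))) ⟩
      Σ D (λ v → u∣ v * classSum v c)
        ∎
      where
      I = interval 1 N
      D = divisors n
      u∣ : ℕ → Carrier
      u∣ v = 𝟙 (u ∣? v)
      inClass : ℕ → ℕ → Carrier
      inClass x v = 𝟙 (gcdS s x N ℕ.≟ v ^ s)
      χ : ℕ → Carrier
      χ x = E (c ℤ.* + x)

    multipleSum-split : ∀ c → multipleSum u c ≈
      classSum u c + Σ (divisors n) (λ v → if does (v ℕ.≟ u) then 0# else 𝟙 (u ∣? v) * classSum v c)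
    multipleSum-split c = trans (multipleSum≈Σ-classSum c)
      (trans (Σ.fold-divisors-remove _ 0<n u∣n)
             (+-cong (trans (*-cong (𝟙-yes (u ∣? u) ∣-refl) refl) (*-identityˡ _)) refl))

  classSum-invariant : ∀ {c c′} → (∀ {u} → u ∣ n → + N ∣ℤ + (u ^ s) ℤ.* c ⇔ + N ∣ℤ + (u ^ s) ℤ.* c′) →
                       ∀ {t} → t ∣ n → classSum t c ≈ classSum t c′
  classSum-invariant {c} {c′} same {t} t∣n = downward (suc (n ℕ.∸ t)) ℕ.≤-refl t∣n
    where
    larger : ℕ → ℤ → Carrier
    larger u c = Σ (divisors n) (λ v → if does (v ℕ.≟ u) then 0# else 𝟙 (u ∣? v) * classSum v c)
    downward : ∀ fuel {u} → n ℕ.∸ u < fuel → u ∣ n → classSum u c ≈ classSum u c′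
    downward (suc fuel) {u} n∸u<1+fuel u∣n = ∙-cancelʳ (larger u c) (classSum u c) (classSum u c′) (begin
      classSum u c + larger u c     ≈⟨ multipleSum-split u∣n c ⟨
      multipleSum u c               ≈⟨ multipleSum-invariant u∣n (same u∣n) ⟩
      multipleSum u c′              ≈⟨ multipleSum-split u∣n c′ ⟩
      classSum u c′ + larger u c′   ≈⟨ +-cong refl (Σ.fold-divisors-cong n larger-term) ⟨
      classSum u c′ + larger u c    ∎)
      where
      larger-term : ∀ {v} → v ∣ n → (if does (v ℕ.≟ u) then 0# else 𝟙 (u ∣? v) * classSum v c)
                                  ≈ (if does (v ℕ.≟ u) then 0# else 𝟙 (u ∣? v) * classSum v c′)
      larger-term {v} v∣n = Σ.if-dec-congʳ (v ℕ.≟ u) (λ v≢u → 𝟙-guard (u ∣? v) (λ u∣v →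
        downward fuel (n∸v<fuel u∣v (λ u≡v → v≢u (≡.sym u≡v))) v∣n))
        where
        n∸v<fuel : u ∣ v → ¬ u ≡ v → n ℕ.∸ v < fuel
        n∸v<fuel u∣v u≢v = ℕ.<-≤-trans (ℕ.∸-monoʳ-< (ℕ.≤∧≢⇒< (∣⇒≤ {{ℕ.>-nonZero (∣-pos 0<n v∣n)}} u∣v) u≢v)
                                                     (∣⇒≤ {{ℕ.>-nonZero 0<n}} v∣n))
                                       (ℕ.≤-pred n∸u<1+fuel)

  classSum-neg : ∀ {t} m → t ∣ n → classSum t (ℤ.- m) ≈ classSum t m
  classSum-neg m = classSum-invariant (λ {u} _ → mk⇔ (to (+ (u ^ s))) (from (+ (u ^ s))))
    where
    negate : ∀ U m → U ℤ.* (ℤ.- m) ≡ ℤ.- (U ℤ.* m)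
    negate = solve-∀
    to : ∀ U → + N ∣ℤ U ℤ.* (ℤ.- m) → + N ∣ℤ U ℤ.* m
    to U = ≡.subst (+ N ∣ℤ_) (ℤ.neg-involutive (U ℤ.* m)) ∘ ∣m⇒∣-m ∘ ≡.subst (+ N ∣ℤ_) (negate U m)
    from : ∀ U → + N ∣ℤ U ℤ.* m → + N ∣ℤ U ℤ.* (ℤ.- m)
    from U = ≡.subst (+ N ∣ℤ_) (≡.sym (negate U m)) ∘ ∣m⇒∣-m

  classSum-classOf : ∀ m m′ → classOf m ≡ classOf m′ → ∀ {t} → t ∣ n → classSum t (+ m) ≈ classSum t (+ m′)
  classSum-classOf m m′ same-class = classSum-invariant (λ {u} u∣n →
    ⇔.trans (via-class u∣n m) (≡.subst (λ r → divN n u ∣ r ⇔ + N ∣ℤ + (u ^ s) ℤ.* + m′) (≡.sym same-class)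
                                       (⇔.sym (via-class u∣n m′))))
    where
    via-class : ∀ {u} → u ∣ n → ∀ m → + N ∣ℤ + (u ^ s) ℤ.* + m ⇔ divN n u ∣ classOf m
    via-class {u} u∣n m = ⇔.trans (≡.subst (λ z → + N ∣ℤ z ⇔ N ∣ u ^ s ℕ.* m) (ℤ.pos-* (u ^ s) m) +∣+⇔∣)
                                  (N∣T*m⇔ u∣n m)

  Σ-divisors-class : ∀ m → Σ (divisors n) (λ d → 𝟙 (gcdS s m N ℕ.≟ divN n d ^ s)) ≈ 1#
  Σ-divisors-class m =
    trans (Σ.fold-divisors-single 0<n (divN-∣ (classOf∣n m)) other-divisors)
          (𝟙-yes (gcdS s m N ℕ.≟ divN n d₀ ^ s) (≡.cong (_^ s) (≡.sym (divN-involutive 0<n (classOf∣n m)))))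
    where
    d₀ = divN n (classOf m)
    other-divisors : ∀ {d} → d ∣ n → ¬ d ≡ d₀ → 𝟙 (gcdS s m N ℕ.≟ divN n d ^ s) ≈ 0#
    other-divisors {d} d∣n d≢d₀ = 𝟙-no (gcdS s m N ℕ.≟ divN n d ^ s) (λ eq → d≢d₀
      (≡.trans (≡.sym (divN-involutive 0<n d∣n))
               (≡.cong (divN n) (≡.sym (Equivalence.to (gcdS≡^⇔gcdRoot≡ s 0<s 0<N m (divN n d)) eq)))))

module Counting {c ℓ : Level} (R : CommutativeRing c ℓ) (domain : IsIntegralDomain R)
                (s n k : ℕ) (0<s : 0 < s) (0<n : 0 < n) (b : ℤ) (t : Fin k → ℕ) (t∣n : ∀ i → t i ∣ n)
                (ζ : CommutativeRing.Carrier R) (ζ-primitive : IsPrimitiveRoot R ζ (n ^ s)) where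
  open CommutativeRing R
  open RingSums R
  open Arithmetic
  open DivisorClasses s n 0<s 0<n
  open IntegerResidues
  open ClassSums R domain s n 0<s 0<n ζ ζ-primitive
  open import Relation.Binary.Reasoning.Setoid setoid
  open import Data.Integer.Tactic.RingSolver using (solve-∀)

  classProduct : ℤ → Carrier
  classProduct c = Π (Vec.toList (Vec.tabulate t)) (λ y → classSum y c)

  inClasses? : ∀ x y → Dec (gcdS s x N ≡ y ^ s)
  inClasses? x y = gcdS s x N ℕ.≟ y ^ s

  inAllClasses? : (xs : Vec ℕ k) → Dec (All (λ xy → gcdS s (proj₁ xy) N ≡ proj₂ xy ^ s) (Vec.zip xs (Vec.tabulate t)))
  inAllClasses? xs = All.all? (λ xy → inClasses? (proj₁ xy) (proj₂ xy)) (Vec.zip xs (Vec.tabulate t))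

  congruent? : (xs : Vec ℕ k) → Dec (modZ (+ Vec.sum xs ℤ.- b) N ≡ 0)
  congruent? xs = modZ (+ Vec.sum xs ℤ.- b) N ℕ.≟ 0

  natR-countSol : natR R (countSol n s k t b) ≈ Σ (tuples k (interval 1 N)) (λ xs → 𝟙 (inAllClasses? xs) * 𝟙 (congruent? xs))
  natR-countSol = begin
    natR R (countSol n s k t b)
      ≈⟨ natR-length-filter (λ xs → inAllClasses? xs ×-dec congruent? xs) L ⟩
    Σ L (λ xs → 𝟙 (inAllClasses? xs ×-dec congruent? xs))
      ≈⟨ Σ.fold-cong L (λ xs → 𝟙-×-dec (inAllClasses? xs) (congruent? xs)) ⟩
    Σ L (λ xs → 𝟙 (inAllClasses? xs) * 𝟙 (congruent? xs))
      ≡⟨ ≡.cong (λ L → Σ (tuples k L) (λ xs → 𝟙 (inAllClasses? xs) * 𝟙 (congruent? xs))) (range-1 N) ⟩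
    Σ (tuples k (interval 1 N)) (λ xs → 𝟙 (inAllClasses? xs) * 𝟙 (congruent? xs)) ∎
    where
    L = tuples k (range 1 N)

  congruent⇔ : (xs : Vec ℕ k) → modZ (+ Vec.sum xs ℤ.- b) N ≡ 0 ⇔ + N ∣ℤ b ℤ.- + Vec.sum xs
  congruent⇔ xs = ⇔.trans (≡.subst (λ r → r ≡ 0 ⇔ + N ∣ℤ + Vec.sum xs ℤ.- b) (≡.sym (modZ≡%ℕ (+ Vec.sum xs ℤ.- b) N))
                                   (⇔.sym (∣⇔%ℕ≡0 N)))
                          (mk⇔ (flip (+ Vec.sum xs) b) (flip b (+ Vec.sum xs)))
    where
    flip : ∀ x y → + N ∣ℤ x ℤ.- y → + N ∣ℤ y ℤ.- x
    flip x y N∣ = ≡.subst (+ N ∣ℤ_) (negate x y) (∣m⇒∣-m N∣)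
      where
      negate : ∀ x y → ℤ.- (x ℤ.- y) ≡ y ℤ.- x
      negate = solve-∀

  N*𝟙-congruent : (xs : Vec ℕ k) → natR R N * 𝟙 (congruent? xs) ≈ Σ (interval 1 N) (λ m → E (+ m ℤ.* (b ℤ.- + Vec.sum xs)))
  N*𝟙-congruent xs = by-cases (congruent? xs)
    where
    by-cases : (d : Dec (modZ (+ Vec.sum xs ℤ.- b) N ≡ 0)) →
               natR R N * 𝟙 d ≈ Σ (interval 1 N) (λ m → E (+ m ℤ.* (b ℤ.- + Vec.sum xs)))
    by-cases (yes ≡0) = trans (*-identityʳ _) (sym (Σ-E-∣ {b ℤ.- + Vec.sum xs} N (Equivalence.to (congruent⇔ xs) ≡0)))
    by-cases (no ≢0)  = trans (zeroʳ _) (sym (Σ-E-∤ domain {b ℤ.- + Vec.sum xs} N (≢0 ∘ Equivalence.from (congruent⇔ xs))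
                                                    (divides (b ℤ.- + Vec.sum xs) (ℤ.*-comm (+ N) _))))

  E-sum : ∀ c {j} (xs : Vec ℕ j) → E (c ℤ.* + Vec.sum xs) ≈ Π (Vec.toList xs) (λ x → E (c ℤ.* + x))
  E-sum c []       = Equivalence.from (E≈1⇔∣ (c ℤ.* + 0)) (divides (+ 0) (ℤ.*-zeroʳ c))
  E-sum c (x ∷ xs) = begin
    E (c ℤ.* + (x ℕ.+ Vec.sum xs))
      ≡⟨ ≡.cong E (≡.trans (≡.cong (c ℤ.*_) (ℤ.pos-+ x _)) (ℤ.*-distribˡ-+ c (+ x) _)) ⟩
    E (c ℤ.* + x ℤ.+ c ℤ.* + Vec.sum xs)
      ≈⟨ E-+ (c ℤ.* + x) (c ℤ.* + Vec.sum xs) ⟩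
    E (c ℤ.* + x) * E (c ℤ.* + Vec.sum xs)
      ≈⟨ *-cong refl (E-sum c xs) ⟩
    E (c ℤ.* + x) * Π (Vec.toList xs) (λ x → E (c ℤ.* + x)) ∎

  E-split : ∀ m (xs : Vec ℕ k) → E (+ m ℤ.* (b ℤ.- + Vec.sum xs)) ≈ E (+ m ℤ.* b) * Π (Vec.toList xs) (λ x → E (ℤ.- + m ℤ.* + x))
  E-split m xs = begin
    E (+ m ℤ.* (b ℤ.- S))                ≡⟨ ≡.cong E (expand (+ m) b S) ⟩
    E (+ m ℤ.* b ℤ.+ ℤ.- + m ℤ.* S)      ≈⟨ E-+ (+ m ℤ.* b) (ℤ.- + m ℤ.* S) ⟩
    E (+ m ℤ.* b) * E (ℤ.- + m ℤ.* S)    ≈⟨ *-cong refl (E-sum (ℤ.- + m) xs) ⟩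
    E (+ m ℤ.* b) * Π (Vec.toList xs) (λ x → E (ℤ.- + m ℤ.* + x)) ∎
    where
    S = + Vec.sum xs
    expand : ∀ m b S → m ℤ.* (b ℤ.- S) ≡ m ℤ.* b ℤ.+ ℤ.- m ℤ.* S
    expand = solve-∀

  private
    M : List ℕ
    M = interval 1 N

  N*countSol≈Σ-characters : natR R N * natR R (countSol n s k t b) ≈ Σ M (λ m → E (+ m ℤ.* b) * classProduct (ℤ.- + m))
  N*countSol≈Σ-characters = begin
    natR R N * natR R (countSol n s k t b)
      ≈⟨ *-cong refl natR-countSol ⟩
    natR R N * Σ T (λ xs → 𝟙c xs * 𝟙 (congruent? xs))
      ≈⟨ *-distribˡ-Σ (natR R N) T _ ⟩
    Σ T (λ xs → natR R N * (𝟙c xs * 𝟙 (congruent? xs)))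
      ≈⟨ Σ.fold-cong T per-tuple ⟩
    Σ T (λ xs → Σ M (λ m → E (+ m ℤ.* b) * (𝟙c xs * χ m xs)))
      ≈⟨ Σ.fold-comm T M _ ⟩
    Σ M (λ m → Σ T (λ xs → E (+ m ℤ.* b) * (𝟙c xs * χ m xs)))
      ≈⟨ Σ.fold-cong M (λ m → *-distribˡ-Σ (E (+ m ℤ.* b)) T _) ⟨
    Σ M (λ m → E (+ m ℤ.* b) * Σ T (λ xs → 𝟙c xs * χ m xs))
      ≈⟨ Σ.fold-cong M (λ m → *-cong refl (Σ-tuples inClasses? M (λ x → E (ℤ.- + m ℤ.* + x)) (Vec.tabulate t))) ⟩
    Σ M (λ m → E (+ m ℤ.* b) * classProduct (ℤ.- + m))         ∎
    where
    open import Algebra.Properties.CommutativeSemigroup *-commutativeSemigroup using (x∙yz≈y∙xz)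
    T : List (Vec ℕ k)
    T = tuples k M
    𝟙c : Vec ℕ k → Carrier
    𝟙c xs = 𝟙 (inAllClasses? xs)
    χ : ℕ → Vec ℕ k → Carrier
    χ m xs = Π (Vec.toList xs) (λ x → E (ℤ.- + m ℤ.* + x))
    per-tuple : ∀ xs → natR R N * (𝟙c xs * 𝟙 (congruent? xs)) ≈ Σ M (λ m → E (+ m ℤ.* b) * (𝟙c xs * χ m xs))
    per-tuple xs = begin
      natR R N * (𝟙c xs * 𝟙 (congruent? xs))
        ≈⟨ x∙yz≈y∙xz _ _ _ ⟩
      𝟙c xs * (natR R N * 𝟙 (congruent? xs))
        ≈⟨ *-cong refl (N*𝟙-congruent xs) ⟩
      𝟙c xs * Σ M (λ m → E (+ m ℤ.* (b ℤ.- + Vec.sum xs)))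
        ≈⟨ *-cong refl (Σ.fold-cong M (λ m → E-split m xs)) ⟩
      𝟙c xs * Σ M (λ m → E (+ m ℤ.* b) * χ m xs)
        ≈⟨ *-distribˡ-Σ (𝟙c xs) M _ ⟩
      Σ M (λ m → 𝟙c xs * (E (+ m ℤ.* b) * χ m xs))
        ≈⟨ Σ.fold-cong M (λ m → x∙yz≈y∙xz _ _ _) ⟩
      Σ M (λ m → E (+ m ℤ.* b) * (𝟙c xs * χ m xs))           ∎

  classProduct-neg : ∀ m → classProduct (ℤ.- + m) ≈ classProduct (+ m)
  classProduct-neg m = Π.fold-tabulate-cong t (λ i → classSum-neg (+ m) (t∣n i))

  Σ-by-classes : ∀ (f : ℕ → Carrier) → Σ M f ≈ Σ (divisors n) (λ d → Σ M (λ m → 𝟙 (inClasses? m (divN n d)) * f m))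
  Σ-by-classes f = begin
    Σ M f
      ≈⟨ Σ.fold-cong M (λ m → trans (*-cong (Σ-divisors-class m) refl) (*-identityˡ (f m))) ⟨
    Σ M (λ m → Σ (divisors n) (λ d → 𝟙 (inClasses? m (divN n d))) * f m)
      ≈⟨ Σ.fold-cong M (λ m → *-distribʳ-Σ (f m) (divisors n) _) ⟩
    Σ M (λ m → Σ (divisors n) (λ d → 𝟙 (inClasses? m (divN n d)) * f m))
      ≈⟨ Σ.fold-comm M (divisors n) _ ⟩
    Σ (divisors n) (λ d → Σ M (λ m → 𝟙 (inClasses? m (divN n d)) * f m)) ∎

  -- on the class of n/d, every m has the class of (n/d)^s = n^s / d^s
  Σ-class : ∀ {d} → d ∣ n → Σ M (λ m → 𝟙 (inClasses? m (divN n d)) * (E (+ m ℤ.* b) * classProduct (+ m)))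
                            ≈ cohen R ζ N d s b * classProduct (+ divN N (d ^ s))
  Σ-class {d} d∣n = begin
    Σ M (λ m → 𝟙 (inClasses? m e) * (E (+ m ℤ.* b) * classProduct (+ m)))
      ≈⟨ Σ.fold-cong M (λ m → 𝟙-guard (inClasses? m e)
                                 (λ eq → *-cong refl (classProduct-classOf m (divN N (d ^ s)) (class-of m eq)))) ⟩
    Σ M (λ m → 𝟙 (inClasses? m e) * (E (+ m ℤ.* b) * P))
      ≈⟨ Σ.fold-cong M (λ m → sym (*-assoc _ _ _)) ⟩
    Σ M (λ m → 𝟙 (inClasses? m e) * E (+ m ℤ.* b) * P)
      ≈⟨ *-distribʳ-Σ P M _ ⟨
    Σ M (λ m → 𝟙 (inClasses? m e) * E (+ m ℤ.* b)) * P
      ≈⟨ *-cong (Σ.fold-cong M (λ m → *-cong refl (reflexive (≡.cong E (ℤ.*-comm (+ m) b))))) refl ⟩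
    classSum e b * P
      ≈⟨ *-cong (classSum≈cohen b (divN-∣ d∣n)) refl ⟩
    cohen R ζ N (divN n e) s b * P
      ≡⟨ ≡.cong (λ r → cohen R ζ N r s b * P) (divN-involutive 0<n d∣n) ⟩
    cohen R ζ N d s b * P                                                   ∎
    where
    e = divN n d
    P = classProduct (+ divN N (d ^ s))
    class-of : ∀ m → gcdS s m N ≡ e ^ s → classOf m ≡ classOf (divN N (d ^ s))
    class-of m eq = ≡.trans (Equivalence.to (gcdS≡^⇔gcdRoot≡ s 0<s 0<N m e) eq)
                              (≡.sym (≡.trans (≡.cong classOf (divN-^ s 0<n d∣n)) (classOf-^ (divN-∣ d∣n))))
    classProduct-classOf : ∀ m m′ → classOf m ≡ classOf m′ → classProduct (+ m) ≈ classProduct (+ m′)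
    classProduct-classOf m m′ same = Π.fold-tabulate-cong t (λ i → classSum-classOf m m′ same (t∣n i))

  classProduct≈Π-cohen : ∀ c → classProduct c ≈
                         Π (divisors n) (λ dj → pow R (cohen R ζ N (divN n dj) s c) (multiplicity k t dj))
  classProduct≈Π-cohen c = trans (Π.fold-tabulate-cong t (λ i → classSum≈cohen c (t∣n i)))
                                 (Π-multiplicities 0<n t t∣n (λ y → cohen R ζ N (divN n y) s c))

mainTheorem3 : {c ℓ : Level} (R : CommutativeRing c ℓ) →
    IsIntegralDomain R → CharZero R →
    (s n k : ℕ) → 0 < s → 0 < n → 0 < k → (b : ℤ) →
    (t : Fin k → ℕ) → (∀ i → t i ∣ n) →
    (ζ : CommutativeRing.Carrier R) → IsPrimitiveRoot R ζ (n ^ s) →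
    CommutativeRing._≈_ R
      (CommutativeRing._*_ R (natR R (n ^ s)) (natR R (countSol n s k t b)))
      (sumR R (map (λ d → CommutativeRing._*_ R
                     (cohen R ζ (n ^ s) d s b)
                     (prodR R (map (λ dj → pow R (cohen R ζ (n ^ s) (divN n dj) s (+ divN (n ^ s) (d ^ s)))
                                                  (multiplicity k t dj))
                                   (divisors n))))
                   (divisors n)))
mainTheorem3 R domain _ s n k 0<s 0<n _ b t t∣n ζ ζ-primitive = begin
  natR R N * natR R (countSol n s k t b)
    ≈⟨ N*countSol≈Σ-characters ⟩
  Σ (interval 1 N) (λ m → E (+ m ℤ.* b) * classProduct (ℤ.- + m))
    ≈⟨ Σ.fold-cong (interval 1 N) (λ m → *-cong refl (classProduct-neg m)) ⟩
  Σ (interval 1 N) (λ m → E (+ m ℤ.* b) * classProduct (+ m))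
    ≈⟨ Σ-by-classes _ ⟩
  Σ (divisors n) (λ d → Σ (interval 1 N) (λ m → 𝟙 (inClasses? m (divN n d)) * (E (+ m ℤ.* b) * classProduct (+ m))))
    ≈⟨ Σ.fold-divisors-cong n Σ-class ⟩
  Σ (divisors n) (λ d → cohen R ζ N d s b * classProduct (+ divN N (d ^ s)))
    ≈⟨ Σ.fold-cong (divisors n) (λ d → *-cong refl (classProduct≈Π-cohen (+ divN N (d ^ s)))) ⟩
  Σ (divisors n) (λ d → cohen R ζ N d s b *
                        Π (divisors n) (λ dj → pow R (cohen R ζ N (divN n dj) s (+ divN N (d ^ s))) (multiplicity k t dj)))
    ∎
  where
  open CommutativeRing R
  open RingSums R
  open Counting R domain s n k 0<s 0<n b t t∣n ζ ζ-primitive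
  open Arithmetic.DivisorClasses s n 0<s 0<n using (N)
  open ClassSums R domain s n 0<s 0<n ζ ζ-primitive using (E)
  open import Relation.Binary.Reasoning.Setoid setoid
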